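{- Suppose the EEC computation type $\underline R$ is either a computation-type constant or $\underline I$, and let $(\cdot)^\bullet,(\cdot)^\circ$ be the generic self-translation relative to $\underline R$. For a context $\Gamma=x_1{:}C_1,\ldots,x_n{:}C_n$ write $[\theta^{ -1}(\Gamma)]$ for the simultaneous substitution $[\theta_{C_1}^{ -1}x_1,\ldots,\theta_{C_n}^{ -1}x_n/x_1,\ldots,x_n]$. Then: (1) If $\Gamma\mid-\vdash t:A$, then $\Gamma\mid-\vdash t=(\theta_A\,t^{\bullet\bullet})[\theta^{ -1}(\Gamma)]:A$. (2) If $\Gamma\mid z{:}\underline A\vdash t:\underline B$, then $\Gamma\mid z{:}\underline A\vdash t=(\underline\theta_{\underline B}\{t^{\circ\circ}\})[\underline\theta_{\underline A}^{ -1}\{z\}/k_{k_z}][\theta^{ -1}(\Gamma)]:\underline B$. (Here $t^{\bullet\bullet}=(t^\bullet)^\bullet$, typed $\Gamma^{\bullet\bullet}\mid-\vdash t^{\bullet\bullet}:A^{\bullet\bullet}$, and $t^{\circ\circ}=(t^\circ)^\circ$ is obtained by translating $\Gamma^\bullet\mid k_z{:}\underline B^\circ\vdash t^\circ:\underline A^\circ$, giving $\Gamma^{\bullet\bullet}\mid k_{k_z}{:}\underline A^{\circ\circ}\vdash t^{\circ\circ}:\underline B^{\circ\circ}$.)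
   Context: **EEC (enriched effect calculus).** There are value-type constants $\alpha,\beta,\ldots$ and a disjoint set of computation-type constants $\underline{\alpha},\underline{\beta},\ldots$. Value types $A,B,C$ and computation types $\underline{A},\underline{B},\underline{C},\underline{D}$ are generated by $A::=\alpha\mid 1\mid A\times B\mid A\to B\mid \underline{A}\mid \underline{A}\multimap\underline{B}$ and $\underline{A}::=\underline{\alpha}\mid\underline{1}\mid\underline{A}\,\&\,\underline{B}\mid A\Rightarrow\underline{B}\mid\underline{I}\mid\ !A\mid\ !A\otimes\underline{B}\mid\underline{0}\mid\underline{A}\oplus\underline{B}$ (every computation type is also a value type; $!A\otimes\underline{B}$ is one primitive binary constructor). Judgements are $\Gamma\mid -\vdash t:A$ and $\Gamma\mid z{:}\underline{A}\vdash t:\underline{B}$, where $\Gamma$ lists distinct variables with value types and the "stoup" holds at most one variable, of computation type; with nonempty stoup the result type is a computation type. Below $\Delta$ is empty or $z{:}\underline{D}$. Typing rules: $\Gamma,x{:}A\mid-\vdash x:A$; $\Gamma\mid-\vdash *:1$; pairs $\langle t,u\rangle:A\times B$, projections $\pi_1t,\pi_2t$; $\lambda x{:}A.t:A\to B$ from $\Gamma,x{:}A\mid-\vdash t:B$; application $t\,u$ (all with empty stoup). $\Gamma\mid z{:}\underline A\vdash z:\underline A$; $\Gamma\mid\Delta\vdash\underline{*}:\underline 1$; from $\Gamma\mid\Delta\vdash t:\underline A$, $\Gamma\mid\Delta\vdash u:\underline B$ get $\Gamma\mid\Delta\vdash\langle t,u\rangle_c:\underline A\,\&\,\underline B$, and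 from $\Gamma\mid\Delta\vdash t:\underline A\,\&\,\underline B$ get $\underline\pi_1t:\underline A$, $\underline\pi_2t:\underline B$; from $\Gamma,x{:}A\mid\Delta\vdash t:\underline B$ get $\Gamma\mid\Delta\vdash\underline\lambda x{:}A.t:A\Rightarrow\underline B$; from $\Gamma\mid\Delta\vdash s:A\Rightarrow\underline B$, $\Gamma\mid-\vdash t:A$ get $\Gamma\mid\Delta\vdash s@t:\underline B$; $\Gamma\mid-\vdash\top:\underline I$; from $\Gamma\mid\Delta\vdash t:\underline I$, $\Gamma\mid-\vdash u:\underline A$ get $\Gamma\mid\Delta\vdash \mathrm{let}\ \top\ \mathrm{be}\ t\ \mathrm{in}\ u:\underline A$; from $\Gamma\mid-\vdash t:A$ get $\Gamma\mid-\vdash\,!t:\,!A$; from $\Gamma\mid\Delta\vdash t:\,!A$, $\Gamma,x{:}A\mid-\vdash u:\underline B$ get $\Gamma\mid\Delta\vdash\mathrm{let}\ !x\ \mathrm{be}\ t\ \mathrm{in}\ u:\underline B$; from $\Gamma\mid-\vdash t:A$, $\Gamma\mid\Delta\vdash u:\underline B$ get $\Gamma\mid\Delta\vdash\,!t\otimes u:\,!A\otimes\underline B$; from $\Gamma\mid\Delta\vdash s:\,!A\otimes\underline B$, $\Gamma,x{:}A\mid y{:}\underline B\vdash t:\underline C$ get $\Gamma\mid\Delta\vdash\mathrm{let}\ !x\otimes y\ \mathrm{be}\ s\ \mathrm{in}\ t:\underline C$; from $\Gamma\mid\Delta\vdash t:\underline 0$ get $\Gamma\mid\Delta\vdash\mathrm{abort}_{\underline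 A}(t):\underline A$; $\mathrm{inl}\,t:\underline A\oplus\underline B$ from $t:\underline A$ and $\mathrm{inr}\,t$ from $t:\underline B$ (same $\Gamma\mid\Delta$); from $\Gamma\mid\Delta\vdash s:\underline A\oplus\underline B$, $\Gamma\mid x{:}\underline A\vdash t:\underline C$, $\Gamma\mid y{:}\underline B\vdash u:\underline C$ get $\Gamma\mid\Delta\vdash\mathrm{case}\ s\ \mathrm{of}\ (\mathrm{inl}\,x\Rightarrow t\mid\mathrm{inr}\,y\Rightarrow u):\underline C$; from $\Gamma\mid z{:}\underline A\vdash t:\underline B$ get $\Gamma\mid-\vdash\hat\lambda z{:}\underline A.t:\underline A\multimap\underline B$; from $\Gamma\mid-\vdash s:\underline A\multimap\underline B$, $\Gamma\mid\Delta\vdash t:\underline A$ get $\Gamma\mid\Delta\vdash s\{t\}:\underline B$. Equality $\Gamma\mid\Delta\vdash t=u:A$ is the least typed congruence (equivalence, compatible with all term formers, containing $\alpha$-equivalence) containing all well-typed instances of: $t=*$ for $t:1$; $\pi_1\langle t,u\rangle=t$, $\pi_2\langle t,u\rangle=u$, $\langle\pi_1t,\pi_2t\rangle=t$; $(\lambda x.t)u=t[u/x]$, $\lambda x.(t\,x)=t$ ($x$ not free in $t$); $t=\underline*$ for $t:\underline1$; $\underline\pi_1\langle t,u\rangle_c=t$, $\underline\pi_2\langle t,u\rangle_c=u$, $\langle\underline\pi_1t,\underline\pi_2t\rangle_c=t$; $(\underline\lambda x.t)@u=t[u/x]$, $\underline\lambda x.(t@x)=t$ ($x$ not free); $\mathrm{let}\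 \top\ \mathrm{be}\ \top\ \mathrm{in}\ t=t$; $\mathrm{let}\ \top\ \mathrm{be}\ t\ \mathrm{in}\ u[\top/x]=u[t/x]$ for $\Gamma\mid x{:}\underline I\vdash u:\underline A$; $\mathrm{let}\ !x\ \mathrm{be}\ !t\ \mathrm{in}\ u=u[t/x]$; $\mathrm{let}\ !x\ \mathrm{be}\ t\ \mathrm{in}\ u[!x/y]=u[t/y]$ for $\Gamma\mid y{:}\,!A\vdash u:\underline B$; $\mathrm{let}\ !x\otimes y\ \mathrm{be}\ !t\otimes s\ \mathrm{in}\ u=u[t/x,s/y]$; $\mathrm{let}\ !x\otimes y\ \mathrm{be}\ t\ \mathrm{in}\ u[(!x\otimes y)/z]=u[t/z]$ for $\Gamma\mid z{:}\,!A\otimes\underline B\vdash u:\underline C$; $\mathrm{abort}_{\underline A}(t)=u[t/x]$ for $\Gamma\mid x{:}\underline 0\vdash u:\underline A$; $\mathrm{case}\ \mathrm{inl}\,t\ \mathrm{of}\ (\mathrm{inl}\,x\Rightarrow u\mid\mathrm{inr}\,y\Rightarrow u')=u[t/x]$ and symmetrically for $\mathrm{inr}$; $\mathrm{case}\ t\ \mathrm{of}\ (\mathrm{inl}\,x\Rightarrow u[\mathrm{inl}\,x/z]\mid\mathrm{inr}\,y\Rightarrow u[\mathrm{inr}\,y/z])=u[t/z]$ for $\Gamma\mid z{:}\underline A\oplus\underline B\vdash u:\underline C$; $(\hat\lambda x.t)\{u\}=t[u/x]$, $\hat\lambda x.(t\{x\})=t$ ($x$ not free). **Generic self-translation relative to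 a computation type $\underline R$.** Types: $\alpha^\bullet=\alpha$, $1^\bullet=1$, $(A\times B)^\bullet=A^\bullet\times B^\bullet$, $(A\to B)^\bullet=A^\bullet\to B^\bullet$, $\underline A^\bullet=\underline A^\circ\multimap\underline R$ (a computation type viewed as a value type), $(\underline A\multimap\underline B)^\bullet=\underline B^\circ\multimap\underline A^\circ$; $\underline\alpha^\circ=\underline\alpha$ if $\underline\alpha\neq\underline R$ and $\underline\alpha^\circ=\underline I$ if $\underline R$ is the constant $\underline\alpha$; $\underline1^\circ=\underline0$; $(\underline A\,\&\,\underline B)^\circ=\underline A^\circ\oplus\underline B^\circ$; $(A\Rightarrow\underline B)^\circ=\,!(A^\bullet)\otimes\underline B^\circ$; $\underline I^\circ=\underline R$; $(!A)^\circ=A^\bullet\Rightarrow\underline R$; $(!A\otimes\underline B)^\circ=A^\bullet\Rightarrow\underline B^\circ$; $\underline0^\circ=\underline1$; $(\underline A\oplus\underline B)^\circ=\underline A^\circ\,\&\,\underline B^\circ$. For $\Gamma=x_1{:}C_1,\ldots,x_n{:}C_n$, $\Gamma^\bullet=x_1{:}C_1^\bullet,\ldots,x_n{:}C_n^\bullet$. To each variable $z$ is associated a distinct fresh variable $k_z$ (so iterating gives $k_{k_z}$); $k,h,k_x,k_y$ below are fresh bound variables. Terms: a judgement $\Gamma\mid-\vdash t:A$ goes to $\Gamma^\bullet\mid-\vdash t^\bullet:A^\bullet$, and $\Gamma\mid z{:}\underline D\vdash t:\underline B$ goes to $\Gamma^\bullet\mid k_z{:}\underline B^\circ\vdash t^\circ:\underline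 D^\circ$ (contravariantly); type names below refer to the typing rules. Value clauses: $x^\bullet=x$; $*^\bullet=*$; $\langle t,u\rangle^\bullet=\langle t^\bullet,u^\bullet\rangle$; $(\pi_it)^\bullet=\pi_it^\bullet$; $(\lambda x{:}A.t)^\bullet=\lambda x{:}A^\bullet.t^\bullet$; $(t\,u)^\bullet=t^\bullet\,u^\bullet$; $\underline*^\bullet=\hat\lambda k{:}\underline0.\,\mathrm{abort}_{\underline R}(k)$; $\langle t,u\rangle_c^\bullet=\hat\lambda k{:}\underline A^\circ\oplus\underline B^\circ.\,\mathrm{case}\ k\ \mathrm{of}\ (\mathrm{inl}\,k_x\Rightarrow t^\bullet\{k_x\}\mid\mathrm{inr}\,k_y\Rightarrow u^\bullet\{k_y\})$; $(\underline\pi_1t)^\bullet=\hat\lambda k{:}\underline A^\circ.\,t^\bullet\{\mathrm{inl}\,k\}$; $(\underline\pi_2t)^\bullet=\hat\lambda k{:}\underline B^\circ.\,t^\bullet\{\mathrm{inr}\,k\}$; $(\underline\lambda x{:}A.t)^\bullet=\hat\lambda k{:}\,!A^\bullet\otimes\underline B^\circ.\,\mathrm{let}\ !x\otimes h\ \mathrm{be}\ k\ \mathrm{in}\ t^\bullet\{h\}$; $(s@t)^\bullet=\hat\lambda k{:}\underline B^\circ.\,s^\bullet\{!(t^\bullet)\otimes k\}$; $\top^\bullet=\hat\lambda k{:}\underline R.\,k$; $(\mathrm{let}\ \top\ \mathrm{be}\ t\ \mathrm{in}\ u)^\bullet=\hat\lambda k{:}\underline A^\circ.\,t^\bullet\{u^\bullet\{k\}\}$;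 $(!t)^\bullet=\hat\lambda k{:}A^\bullet\Rightarrow\underline R.\,k@t^\bullet$; $(\mathrm{let}\ !x\ \mathrm{be}\ t\ \mathrm{in}\ u)^\bullet=\hat\lambda k{:}\underline B^\circ.\,t^\bullet\{\underline\lambda x{:}A^\bullet.\,u^\bullet\{k\}\}$; $(!t\otimes u)^\bullet=\hat\lambda k{:}A^\bullet\Rightarrow\underline B^\circ.\,u^\bullet\{k@t^\bullet\}$; $(\mathrm{let}\ !x\otimes y\ \mathrm{be}\ s\ \mathrm{in}\ t)^\bullet=\hat\lambda k{:}\underline C^\circ.\,s^\bullet\{\underline\lambda x{:}A^\bullet.\,t^\circ[k/k_y]\}$; $(\mathrm{abort}_{\underline A}(t))^\bullet=\hat\lambda k{:}\underline A^\circ.\,t^\bullet\{\underline*\}$; $(\mathrm{inl}\,t)^\bullet=\hat\lambda k{:}\underline A^\circ\,\&\,\underline B^\circ.\,t^\bullet\{\underline\pi_1k\}$; $(\mathrm{inr}\,t)^\bullet=\hat\lambda k{:}\underline A^\circ\,\&\,\underline B^\circ.\,t^\bullet\{\underline\pi_2k\}$; $(\mathrm{case}\ s\ \mathrm{of}\ (\mathrm{inl}\,x\Rightarrow t\mid\mathrm{inr}\,y\Rightarrow u))^\bullet=\hat\lambda k{:}\underline C^\circ.\,s^\bullet\{\langle t^\circ[k/k_x],u^\circ[k/k_y]\rangle_c\}$; $(\hat\lambda z{:}\underline A.t)^\bullet=\hat\lambda k{:}\underline B^\circ.\,t^\circ[k/k_z]$; $(s\{t\})^\bullet=\hat\lambda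 k{:}\underline B^\circ.\,t^\bullet\{s^\bullet\{k\}\}$. Computation clauses (stoup $z{:}\underline D$): $z^\circ=k_z$; $\underline*^\circ=\mathrm{abort}_{\underline D^\circ}(k_z)$; $\langle t,u\rangle_c^\circ=\mathrm{case}\ k_z\ \mathrm{of}\ (\mathrm{inl}\,k_x\Rightarrow t^\circ[k_x/k_z]\mid\mathrm{inr}\,k_y\Rightarrow u^\circ[k_y/k_z])$; $(\underline\pi_1t)^\circ=t^\circ[\mathrm{inl}\,k_z/k_z]$; $(\underline\pi_2t)^\circ=t^\circ[\mathrm{inr}\,k_z/k_z]$; $(\underline\lambda x{:}A.t)^\circ=\mathrm{let}\ !x\otimes h\ \mathrm{be}\ k_z\ \mathrm{in}\ t^\circ[h/k_z]$; $(s@t)^\circ=s^\circ[(!(t^\bullet)\otimes k_z)/k_z]$; $(\mathrm{let}\ \top\ \mathrm{be}\ t\ \mathrm{in}\ u)^\circ=t^\circ[u^\bullet\{k_z\}/k_z]$; $(\mathrm{let}\ !x\ \mathrm{be}\ t\ \mathrm{in}\ u)^\circ=t^\circ[(\underline\lambda x{:}A^\bullet.\,u^\bullet\{k_z\})/k_z]$; $(!t\otimes u)^\circ=u^\circ[(k_z@t^\bullet)/k_z]$; $(\mathrm{let}\ !x\otimes y\ \mathrm{be}\ s\ \mathrm{in}\ t)^\circ=s^\circ[(\underline\lambda x{:}A^\bullet.\,t^\circ[k_z/k_y])/k_z]$; $(\mathrm{abort}(t))^\circ=t^\circ[\underline*/k_z]$; $(\mathrm{inl}\,t)^\circ=t^\circ[\underline\pi_1k_z/k_z]$;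 $(\mathrm{inr}\,t)^\circ=t^\circ[\underline\pi_2k_z/k_z]$; $(\mathrm{case}\ s\ \mathrm{of}\ (\mathrm{inl}\,x\Rightarrow t\mid\mathrm{inr}\,y\Rightarrow u))^\circ=s^\circ[\langle t^\circ[k_z/k_x],u^\circ[k_z/k_y]\rangle_c/k_z]$; $(s\{t\})^\circ=t^\circ[s^\bullet\{k_z\}/k_z]$. **Isomorphisms $\theta_A:A^{\bullet\bullet}\to A$ and $\underline\theta_{\underline A}:\underline A^{\circ\circ}\multimap\underline A$** (closed terms; when $\underline R$ is a computation-type constant or $\underline I$ each has an inverse $\theta_A^{ -1}$, resp. linear inverse $\underline\theta_{\underline A}^{ -1}$, unique up to provable equality, and the definition below, by simultaneous induction on types with $\underline\theta_{\underline A}$ before $\theta_{\underline A}$, uses these inverses at smaller types): $\theta_\alpha=\lambda x{:}\alpha.x$; $\theta_1=\lambda x{:}1.*$; $\theta_{A\times B}=\lambda z{:}A^{\bullet\bullet}\times B^{\bullet\bullet}.\langle\theta_A(\pi_1z),\theta_B(\pi_2z)\rangle$; $\theta_{A\to B}=\lambda f{:}A^{\bullet\bullet}\to B^{\bullet\bullet}.\lambda x{:}A.\,\theta_B(f(\theta_A^{ -1}x))$; $\theta_{\underline A}=\lambda h{:}\underline I\multimap\underline A^{\circ\circ}.\,\underline\theta_{\underline A}\{h\{\top\}\}$; $\theta_{\underline A\multimap\underline B}=\lambda h{:}\underline A^{\circ\circ}\multimap\underline B^{\circ\circ}.\,\hat\lambda x{:}\underline A.\,\underline\theta_{\underline B}\{h\{\underline\theta_{\underline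 A}^{ -1}\{x\}\}\}$; $\underline\theta_{\underline\alpha}=\hat\lambda z{:}\underline\alpha.z$; $\underline\theta_{\underline1}=\hat\lambda z{:}\underline1.\underline*$; $\underline\theta_{\underline A\&\underline B}=\hat\lambda z{:}\underline A^{\circ\circ}\,\&\,\underline B^{\circ\circ}.\langle\underline\theta_{\underline A}\{\underline\pi_1z\},\underline\theta_{\underline B}\{\underline\pi_2z\}\rangle_c$; $\underline\theta_{A\Rightarrow\underline B}=\hat\lambda f{:}A^{\bullet\bullet}\Rightarrow\underline B^{\circ\circ}.\,\underline\lambda x{:}A.\,\underline\theta_{\underline B}\{f@(\theta_A^{ -1}x)\}$; $\underline\theta_{\underline I}=\hat\lambda z{:}\underline I.z$; $\underline\theta_{!A}=\hat\lambda z{:}\,!(A^{\bullet\bullet})\otimes\underline I.\,\mathrm{let}\ !x\otimes y\ \mathrm{be}\ z\ \mathrm{in}\ \mathrm{let}\ \top\ \mathrm{be}\ y\ \mathrm{in}\ !(\theta_Ax)$; $\underline\theta_{!A\otimes\underline B}=\hat\lambda z{:}\,!(A^{\bullet\bullet})\otimes\underline B^{\circ\circ}.\,\mathrm{let}\ !x\otimes y\ \mathrm{be}\ z\ \mathrm{in}\ !(\theta_Ax)\otimes(\underline\theta_{\underline B}\{y\})$; $\underline\theta_{\underline0}=\hat\lambda z{:}\underline0.z$; $\underline\theta_{\underline A\oplus\underline B}=\hat\lambda z{:}\underline A^{\circ\circ}\oplus\underline B^{\circ\circ}.\,\mathrm{case}\ z\ \mathrm{of}\ (\mathrm{inl}\,x\Rightarrow\mathrm{inl}(\underline\theta_{\underline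 A}\{x\})\mid\mathrm{inr}\,y\Rightarrow\mathrm{inr}(\underline\theta_{\underline B}\{y\}))$. -}

module Defs where

open import Data.Nat using (ℕ; zero; suc; _≡ᵇ_)
open import Data.Nat.Properties using (≡ᵇ⇒≡)
open import Data.Bool using (Bool; true; false; T)
open import Data.Unit using (tt)
open import Data.List using (List; []; _∷_)
open import Data.Maybe using (Maybe; just; nothing)
open import Data.Product using (Σ; _,_; _×_)
open import Data.Sum using (_⊎_; inj₁; inj₂)
open import Relation.Binary.PropositionalEquality using (_≡_; refl; sym; cong; subst)

infixr 20 _t×_
infixr 15 _t→_
infixr 15 _⊸_
infixr 20 _&_
infixr 20 _⊕_
infixr 15 _⇒_
infixr 18 _!⊗_

mutual
  data VTy : Set where
    tcon  : ℕ → VTy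
    t1    : VTy
    _t×_  : VTy → VTy → VTy
    _t→_  : VTy → VTy → VTy
    U     : CTy → VTy
    _⊸_   : CTy → CTy → VTy

  data CTy : Set where
    ccon  : ℕ → CTy
    c1    : CTy
    _&_   : CTy → CTy → CTy
    _⇒_   : VTy → CTy → CTy
    cI    : CTy
    !_    : VTy → CTy
    _!⊗_  : VTy → CTy → CTy        -- !A ⊗ B̲   (one primitive constructor)
    c0    : CTy
    _⊕_   : CTy → CTy → CTy

-- Contexts (de Bruijn; the head of the list is the most recent variable)
-- and the stoup (empty = nothing, or one variable of computation type).

Ctx : Set
Ctx = List VTy

Stoup : Set
Stoup = Maybe CTy

infix 4 _∋_
data _∋_ : Ctx → VTy → Set where
  here  : ∀ {Γ A} → (A ∷ Γ) ∋ A
  there : ∀ {Γ A B} → Γ ∋ A → (B ∷ Γ) ∋ A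

variable
  Γ Γ' : Ctx
  Δ : Stoup
  A B C : VTy
  TT : VTy
  X Y Z D : CTy

-- The stoup variable is nameless (`sv`): it refers to the
-- unique stoup variable in scope (stoup binders: λ̂, case branches, and the
-- body of let !x ⊗ y).  With nonempty stoup the result type is always of
-- the form U B̲ (a computation type).

data Tm (Γ : Ctx) : Stoup → VTy → Set where
  var     : Γ ∋ A → Tm Γ nothing A
  unit    : Tm Γ nothing t1
  pair    : Tm Γ nothing A → Tm Γ nothing B → Tm Γ nothing (A t× B)
  fst     : Tm Γ nothing (A t× B) → Tm Γ nothing A
  snd     : Tm Γ nothing (A t× B) → Tm Γ nothing B
  lam     : Tm (A ∷ Γ) nothing B → Tm Γ nothing (A t→ B)
  app     : Tm Γ nothing (A t→ B) → Tm Γ nothing A → Tm Γ nothing B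
  sv      : Tm Γ (just X) (U X)
  cunit   : Tm Γ Δ (U c1)
  cpair   : Tm Γ Δ (U X) → Tm Γ Δ (U Y) → Tm Γ Δ (U (X & Y))
  cfst    : Tm Γ Δ (U (X & Y)) → Tm Γ Δ (U X)
  csnd    : Tm Γ Δ (U (X & Y)) → Tm Γ Δ (U Y)
  clam    : Tm (A ∷ Γ) Δ (U Y) → Tm Γ Δ (U (A ⇒ Y))
  capp    : Tm Γ Δ (U (A ⇒ Y)) → Tm Γ nothing A → Tm Γ Δ (U Y)
  top     : Tm Γ nothing (U cI)
  lettop  : Tm Γ Δ (U cI) → Tm Γ nothing (U X) → Tm Γ Δ (U X)
  bang    : Tm Γ nothing A → Tm Γ nothing (U (! A))
  letbang : Tm Γ Δ (U (! A)) → Tm (A ∷ Γ) nothing (U Y) → Tm Γ Δ (U Y)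
  tens    : Tm Γ nothing A → Tm Γ Δ (U Y) → Tm Γ Δ (U (A !⊗ Y))
  lettens : Tm Γ Δ (U (A !⊗ Y)) → Tm (A ∷ Γ) (just Y) (U Z) → Tm Γ Δ (U Z)
  abort   : Tm Γ Δ (U c0) → Tm Γ Δ (U X)
  inl     : Tm Γ Δ (U X) → Tm Γ Δ (U (X ⊕ Y))
  inr     : Tm Γ Δ (U Y) → Tm Γ Δ (U (X ⊕ Y))
  case    : Tm Γ Δ (U (X ⊕ Y)) → Tm Γ (just X) (U Z) → Tm Γ (just Y) (U Z)
          → Tm Γ Δ (U Z)
  llam    : Tm Γ (just X) (U Y) → Tm Γ nothing (X ⊸ Y)
  lapp    : Tm Γ nothing (X ⊸ Y) → Tm Γ Δ (U X) → Tm Γ Δ (U Y)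

Ren : Ctx → Ctx → Set
Ren Γ Γ' = ∀ {A} → Γ ∋ A → Γ' ∋ A

ext : Ren Γ Γ' → Ren (B ∷ Γ) (B ∷ Γ')
ext ρ here      = here
ext ρ (there x) = there (ρ x)

ren : Ren Γ Γ' → Tm Γ Δ TT → Tm Γ' Δ TT
ren ρ (var x)         = var (ρ x)
ren ρ unit            = unit
ren ρ (pair t u)      = pair (ren ρ t) (ren ρ u)
ren ρ (fst t)         = fst (ren ρ t)
ren ρ (snd t)         = snd (ren ρ t)
ren ρ (lam t)         = lam (ren (ext ρ) t)
ren ρ (app t u)       = app (ren ρ t) (ren ρ u)
ren ρ sv              = sv
ren ρ cunit           = cunit
ren ρ (cpair t u)     = cpair (ren ρ t) (ren ρ u)
ren ρ (cfst t)        = cfst (ren ρ t)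
ren ρ (csnd t)        = csnd (ren ρ t)
ren ρ (clam t)        = clam (ren (ext ρ) t)
ren ρ (capp t u)      = capp (ren ρ t) (ren ρ u)
ren ρ top             = top
ren ρ (lettop t u)    = lettop (ren ρ t) (ren ρ u)
ren ρ (bang t)        = bang (ren ρ t)
ren ρ (letbang t u)   = letbang (ren ρ t) (ren (ext ρ) u)
ren ρ (tens t u)      = tens (ren ρ t) (ren ρ u)
ren ρ (lettens t u)   = lettens (ren ρ t) (ren (ext ρ) u)
ren ρ (abort t)       = abort (ren ρ t)
ren ρ (inl t)         = inl (ren ρ t)
ren ρ (inr t)         = inr (ren ρ t)
ren ρ (case s t u)    = case (ren ρ s) (ren ρ t) (ren ρ u)
ren ρ (llam t)        = llam (ren ρ t)
ren ρ (lapp t u)      = lapp (ren ρ t) (ren ρ u)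

wk : Tm Γ Δ TT → Tm (B ∷ Γ) Δ TT
wk = ren there

cl : Tm [] Δ TT → Tm Γ Δ TT
cl = ren (λ ())

Sub : Ctx → Ctx → Set
Sub Γ Γ' = ∀ {A} → Γ ∋ A → Tm Γ' nothing A

exts : Sub Γ Γ' → Sub (B ∷ Γ) (B ∷ Γ')
exts σ here      = var here
exts σ (there x) = wk (σ x)

sub : Sub Γ Γ' → Tm Γ Δ TT → Tm Γ' Δ TT
sub σ (var x)         = σ x
sub σ unit            = unit
sub σ (pair t u)      = pair (sub σ t) (sub σ u)
sub σ (fst t)         = fst (sub σ t)
sub σ (snd t)         = snd (sub σ t)
sub σ (lam t)         = lam (sub (exts σ) t)
sub σ (app t u)       = app (sub σ t) (sub σ u)
sub σ sv              = sv
sub σ cunit           = cunit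
sub σ (cpair t u)     = cpair (sub σ t) (sub σ u)
sub σ (cfst t)        = cfst (sub σ t)
sub σ (csnd t)        = csnd (sub σ t)
sub σ (clam t)        = clam (sub (exts σ) t)
sub σ (capp t u)      = capp (sub σ t) (sub σ u)
sub σ top             = top
sub σ (lettop t u)    = lettop (sub σ t) (sub σ u)
sub σ (bang t)        = bang (sub σ t)
sub σ (letbang t u)   = letbang (sub σ t) (sub (exts σ) u)
sub σ (tens t u)      = tens (sub σ t) (sub σ u)
sub σ (lettens t u)   = lettens (sub σ t) (sub (exts σ) u)
sub σ (abort t)       = abort (sub σ t)
sub σ (inl t)         = inl (sub σ t)
sub σ (inr t)         = inr (sub σ t)
sub σ (case s t u)    = case (sub σ s) (sub σ t) (sub σ u)
sub σ (llam t)        = llam (sub σ t)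
sub σ (lapp t u)      = lapp (sub σ t) (sub σ u)

_[_] : Tm (A ∷ Γ) Δ TT → Tm Γ nothing A → Tm Γ Δ TT
_[_] {A = A} {Γ = Γ} t u = sub σ t
  where
  σ : Sub (A ∷ Γ) Γ
  σ here      = u
  σ (there x) = var x

-- Substitution for the stoup variable:  ssub t s = t[s/z]  where
-- Γ | z:X ⊢ t and Γ | Δ ⊢ s : X, giving Γ | Δ ⊢ t[s/z].
-- (Stoup binders shadow z, so we never descend into their bodies.)

ssub : Tm Γ (just X) TT → Tm Γ Δ (U X) → Tm Γ Δ TT
ssub sv            s = s
ssub cunit         s = cunit
ssub (cpair t u)   s = cpair (ssub t s) (ssub u s)
ssub (cfst t)      s = cfst (ssub t s)
ssub (csnd t)      s = csnd (ssub t s)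
ssub (clam t)      s = clam (ssub t (wk s))
ssub (capp t u)    s = capp (ssub t s) u
ssub (lettop t u)  s = lettop (ssub t s) u
ssub (letbang t u) s = letbang (ssub t s) u
ssub (tens t u)    s = tens t (ssub u s)
ssub (lettens t u) s = lettens (ssub t s) u
ssub (abort t)     s = abort (ssub t s)
ssub (inl t)       s = inl (ssub t s)
ssub (inr t)       s = inr (ssub t s)
ssub (case r t u)  s = case (ssub r s) t u
ssub (lapp f t)    s = lapp f (ssub t s)

-- The equational theory: Γ | Δ ⊢ t = u : TT  is  t ≋ u.
-- The least typed congruence containing the listed axioms
-- (α-equivalence is built in by de Bruijn indices).

infix 4 _≋_
data _≋_ : {Γ : Ctx} {Δ : Stoup} {TT : VTy} → Tm Γ Δ TT → Tm Γ Δ TT → Set where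
  ≋-refl  : {t : Tm Γ Δ TT} → t ≋ t
  ≋-sym   : {t u : Tm Γ Δ TT} → t ≋ u → u ≋ t
  ≋-trans : {t u v : Tm Γ Δ TT} → t ≋ u → u ≋ v → t ≋ v
  ≋-pair    : {t t' : Tm Γ nothing A} {u u' : Tm Γ nothing B}
            → t ≋ t' → u ≋ u' → pair t u ≋ pair t' u'
  ≋-fst     : {t t' : Tm Γ nothing (A t× B)} → t ≋ t' → fst t ≋ fst t'
  ≋-snd     : {t t' : Tm Γ nothing (A t× B)} → t ≋ t' → snd t ≋ snd t'
  ≋-lam     : {t t' : Tm (A ∷ Γ) nothing B} → t ≋ t' → lam t ≋ lam t'
  ≋-app     : {t t' : Tm Γ nothing (A t→ B)} {u u' : Tm Γ nothing A}
            → t ≋ t' → u ≋ u' → app t u ≋ app t' u'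
  ≋-cpair   : {t t' : Tm Γ Δ (U X)} {u u' : Tm Γ Δ (U Y)}
            → t ≋ t' → u ≋ u' → cpair t u ≋ cpair t' u'
  ≋-cfst    : {t t' : Tm Γ Δ (U (X & Y))} → t ≋ t' → cfst t ≋ cfst t'
  ≋-csnd    : {t t' : Tm Γ Δ (U (X & Y))} → t ≋ t' → csnd t ≋ csnd t'
  ≋-clam    : {t t' : Tm (A ∷ Γ) Δ (U Y)} → t ≋ t' → clam t ≋ clam t'
  ≋-capp    : {t t' : Tm Γ Δ (U (A ⇒ Y))} {u u' : Tm Γ nothing A}
            → t ≋ t' → u ≋ u' → capp t u ≋ capp t' u'
  ≋-lettop  : {t t' : Tm Γ Δ (U cI)} {u u' : Tm Γ nothing (U X)}
            → t ≋ t' → u ≋ u' → lettop t u ≋ lettop t' u'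
  ≋-bang    : {t t' : Tm Γ nothing A} → t ≋ t' → bang t ≋ bang t'
  ≋-letbang : {t t' : Tm Γ Δ (U (! A))} {u u' : Tm (A ∷ Γ) nothing (U Y)}
            → t ≋ t' → u ≋ u' → letbang t u ≋ letbang t' u'
  ≋-tens    : {t t' : Tm Γ nothing A} {u u' : Tm Γ Δ (U Y)}
            → t ≋ t' → u ≋ u' → tens t u ≋ tens t' u'
  ≋-lettens : {t t' : Tm Γ Δ (U (A !⊗ Y))} {u u' : Tm (A ∷ Γ) (just Y) (U Z)}
            → t ≋ t' → u ≋ u' → lettens t u ≋ lettens t' u'
  ≋-abort   : {t t' : Tm Γ Δ (U c0)} → t ≋ t' → abort {X = X} t ≋ abort t'
  ≋-inl     : {t t' : Tm Γ Δ (U X)} → t ≋ t' → inl {Y = Y} t ≋ inl t'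
  ≋-inr     : {t t' : Tm Γ Δ (U Y)} → t ≋ t' → inr {X = X} t ≋ inr t'
  ≋-case    : {s s' : Tm Γ Δ (U (X ⊕ Y))} {t t' : Tm Γ (just X) (U Z)}
              {u u' : Tm Γ (just Y) (U Z)}
            → s ≋ s' → t ≋ t' → u ≋ u' → case s t u ≋ case s' t' u'
  ≋-llam    : {t t' : Tm Γ (just X) (U Y)} → t ≋ t' → llam t ≋ llam t'
  ≋-lapp    : {t t' : Tm Γ nothing (X ⊸ Y)} {u u' : Tm Γ Δ (U X)}
            → t ≋ t' → u ≋ u' → lapp t u ≋ lapp t' u'
  η-1   : (t : Tm Γ nothing t1) → t ≋ unit
  β-×₁  : (t : Tm Γ nothing A) (u : Tm Γ nothing B) → fst (pair t u) ≋ t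
  β-×₂  : (t : Tm Γ nothing A) (u : Tm Γ nothing B) → snd (pair t u) ≋ u
  η-×   : (t : Tm Γ nothing (A t× B)) → pair (fst t) (snd t) ≋ t
  β-→   : (t : Tm (A ∷ Γ) nothing B) (u : Tm Γ nothing A) → app (lam t) u ≋ t [ u ]
  η-→   : (t : Tm Γ nothing (A t→ B)) → lam (app (wk t) (var here)) ≋ t
  η-1̲   : (t : Tm Γ Δ (U c1)) → t ≋ cunit
  β-&₁  : (t : Tm Γ Δ (U X)) (u : Tm Γ Δ (U Y)) → cfst (cpair t u) ≋ t
  β-&₂  : (t : Tm Γ Δ (U X)) (u : Tm Γ Δ (U Y)) → csnd (cpair t u) ≋ u
  η-&   : (t : Tm Γ Δ (U (X & Y))) → cpair (cfst t) (csnd t) ≋ t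
  β-⇒   : (t : Tm (A ∷ Γ) Δ (U Y)) (u : Tm Γ nothing A) → capp (clam t) u ≋ t [ u ]
  η-⇒   : (t : Tm Γ Δ (U (A ⇒ Y))) → clam (capp (wk t) (var here)) ≋ t
  β-I   : (t : Tm Γ nothing (U X)) → lettop top t ≋ t
  η-I   : (u : Tm Γ (just cI) (U X)) (t : Tm Γ Δ (U cI))
        → lettop t (ssub u top) ≋ ssub u t
  β-!   : (t : Tm Γ nothing A) (u : Tm (A ∷ Γ) nothing (U Y))
        → letbang (bang t) u ≋ u [ t ]
  η-!   : (u : Tm Γ (just (! A)) (U Y)) (t : Tm Γ Δ (U (! A)))
        → letbang t (ssub (wk u) (bang (var here))) ≋ ssub u t
  β-⊗   : (t : Tm Γ nothing A) (s : Tm Γ Δ (U Y)) (u : Tm (A ∷ Γ) (just Y) (U Z))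
        → lettens (tens t s) u ≋ ssub (u [ t ]) s
  η-⊗   : (u : Tm Γ (just (A !⊗ Y)) (U Z)) (t : Tm Γ Δ (U (A !⊗ Y)))
        → lettens t (ssub (wk u) (tens (var here) sv)) ≋ ssub u t
  η-0   : (u : Tm Γ (just c0) (U X)) (t : Tm Γ Δ (U c0)) → abort t ≋ ssub u t
  β-⊕₁  : (t : Tm Γ Δ (U X)) (u : Tm Γ (just X) (U Z)) (u' : Tm Γ (just Y) (U Z))
        → case (inl t) u u' ≋ ssub u t
  β-⊕₂  : (t : Tm Γ Δ (U Y)) (u : Tm Γ (just X) (U Z)) (u' : Tm Γ (just Y) (U Z))
        → case (inr t) u u' ≋ ssub u' t
  η-⊕   : (u : Tm Γ (just (X ⊕ Y)) (U Z)) (t : Tm Γ Δ (U (X ⊕ Y)))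
        → case t (ssub u (inl sv)) (ssub u (inr sv)) ≋ ssub u t
  β-⊸   : (t : Tm Γ (just X) (U Y)) (u : Tm Γ Δ (U X)) → lapp (llam t) u ≋ ssub t u
  η-⊸   : (t : Tm Γ nothing (X ⊸ Y)) → llam (lapp t sv) ≋ t

ConstOrI : CTy → Set
ConstOrI R = (Σ ℕ λ n → R ≡ ccon n) ⊎ (R ≡ cI)

isRcon : CTy → ℕ → Bool
isRcon (ccon m) n = m ≡ᵇ n
isRcon c1        n = false
isRcon (_ & _)   n = false
isRcon (_ ⇒ _)   n = false
isRcon cI        n = false
isRcon (! _)     n = false
isRcon (_ !⊗ _)  n = false
isRcon c0        n = false
isRcon (_ ⊕ _)   n = false

conT : Bool → ℕ → CTy
conT true  n = cI
conT false n = ccon n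

module Translation (R : CTy) where

  mutual
    vt : VTy → VTy
    vt (tcon n)  = tcon n
    vt t1        = t1
    vt (A t× B)  = vt A t× vt B
    vt (A t→ B)  = vt A t→ vt B
    vt (U X)     = ct X ⊸ R
    vt (X ⊸ Y)   = ct Y ⊸ ct X

    ct : CTy → CTy
    ct (ccon n)  = conT (isRcon R n) n   -- I̲ if R̲ is the constant α̲, else α̲
    ct c1        = c0
    ct (X & Y)   = ct X ⊕ ct Y
    ct (A ⇒ Y)   = vt A !⊗ ct Y
    ct cI        = R
    ct (! A)     = vt A ⇒ R
    ct (A !⊗ Y)  = vt A ⇒ ct Y
    ct c0        = c1
    ct (X ⊕ Y)   = ct X & ct Y

  ctx : Ctx → Ctx
  ctx []      = []
  ctx (A ∷ Γ) = vt A ∷ ctx Γ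

  trVar : Γ ∋ A → ctx Γ ∋ vt A
  trVar here      = here
  trVar (there x) = there (trVar x)

  mutual
    trV : Tm Γ nothing A → Tm (ctx Γ) nothing (vt A)
    trV (var x)        = var (trVar x)
    trV unit           = unit
    trV (pair t u)     = pair (trV t) (trV u)
    trV (fst t)        = fst (trV t)
    trV (snd t)        = snd (trV t)
    trV (lam t)        = lam (trV t)
    trV (app t u)      = app (trV t) (trV u)
    trV cunit          = llam (abort sv)
    trV (cpair t u)    = llam (case sv (lapp (trV t) sv) (lapp (trV u) sv))
    trV (cfst t)       = llam (lapp (trV t) (inl sv))
    trV (csnd t)       = llam (lapp (trV t) (inr sv))
    trV (clam t)       = llam (lettens sv (lapp (trV t) sv))
    trV (capp s t)     = llam (lapp (trV s) (tens (trV t) sv))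
    trV top            = llam sv
    trV (lettop t u)   = llam (lapp (trV t) (lapp (trV u) sv))
    trV (bang t)       = llam (capp sv (trV t))
    trV (letbang t u)  = llam (lapp (trV t) (clam (lapp (trV u) sv)))
    trV (tens t u)     = llam (lapp (trV u) (capp sv (trV t)))
    trV (lettens s t)  = llam (lapp (trV s) (clam (trC t)))
    trV (abort t)      = llam (lapp (trV t) cunit)
    trV (inl t)        = llam (lapp (trV t) (cfst sv))
    trV (inr t)        = llam (lapp (trV t) (csnd sv))
    trV (case s t u)   = llam (lapp (trV s) (cpair (trC t) (trC u)))
    trV (llam t)       = llam (trC t)
    trV (lapp s t)     = llam (lapp (trV t) (lapp (trV s) sv))

    trC : Tm Γ (just D) (U Y) → Tm (ctx Γ) (just (ct Y)) (U (ct D))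
    trC sv             = sv
    trC cunit          = abort sv
    trC (cpair t u)    = case sv (trC t) (trC u)
    trC (cfst t)       = ssub (trC t) (inl sv)
    trC (csnd t)       = ssub (trC t) (inr sv)
    trC (clam t)       = lettens sv (trC t)
    trC (capp s t)     = ssub (trC s) (tens (trV t) sv)
    trC (lettop t u)   = ssub (trC t) (lapp (trV u) sv)
    trC (letbang t u)  = ssub (trC t) (clam (lapp (trV u) sv))
    trC (tens t u)     = ssub (trC u) (capp sv (trV t))
    trC (lettens s t)  = ssub (trC s) (clam (trC t))
    trC (abort t)      = ssub (trC t) cunit
    trC (inl t)        = ssub (trC t) (cfst sv)
    trC (inr t)        = ssub (trC t) (csnd sv)
    trC (case s t u)   = ssub (trC s) (cpair (trC t) (trC u))
    trC (lapp s t)     = ssub (trC t) (lapp (trV s) sv)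

  -- α̲°° = α̲ (needed to type θ̲_α̲ = λ̂z.z)
  private
    conLem : ∀ n b → isRcon R n ≡ b → ct (conT b n) ≡ ccon n
    conLem n true  e = isRcon-true R e
      where
      isRcon-true : ∀ S → isRcon S n ≡ true → S ≡ ccon n
      isRcon-true (ccon m) e = cong ccon (≡ᵇ⇒≡ m n (subst T (sym e) tt))
      isRcon-true c1 ()
      isRcon-true (_ & _) ()
      isRcon-true (_ ⇒ _) ()
      isRcon-true cI ()
      isRcon-true (! _) ()
      isRcon-true (_ !⊗ _) ()
      isRcon-true c0 ()
      isRcon-true (_ ⊕ _) ()
    conLem n false e = cong (λ b → conT b n) e

  conCC : ∀ n → ct (ct (ccon n)) ≡ ccon n
  conCC n = conLem n (isRcon R n) refl

private
  ≡ᵇ-refl : ∀ n → (n ≡ᵇ n) ≡ true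
  ≡ᵇ-refl zero    = refl
  ≡ᵇ-refl (suc n) = ≡ᵇ-refl n

RI : (R : CTy) → ConstOrI R → Translation.ct R R ≡ cI
RI .(ccon n) (inj₁ (n , refl)) = cong (λ b → conT b n) (≡ᵇ-refl n)
RI .cI       (inj₂ refl)       = refl

-- The isomorphisms θ_A : A•• → A and θ̲_A̲ : A̲°° ⊸ A̲, relative to a
-- choice of inverses at all types (the definition only uses the
-- inverses at smaller types).  Where the paper's type uses R̲° = I̲ or
-- α̲°° = α̲ we transport along the corresponding proof.

module Theta (R : CTy) (RI : Translation.ct R R ≡ cI)
  (invV : (A : VTy) → Tm [] nothing (A t→ Translation.vt R (Translation.vt R A)))
  (invC : (X : CTy) → Tm [] nothing (X ⊸ Translation.ct R (Translation.ct R X)))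
  where
  open Translation R

  mutual
    θV : (A : VTy) → Tm [] nothing (vt (vt A) t→ A)
    θV (tcon n) = lam (var here)
    θV t1       = lam unit
    θV (A t× B) = lam (pair (app (cl (θV A)) (fst (var here)))
                            (app (cl (θV B)) (snd (var here))))
    θV (A t→ B) = lam (lam (app (cl (θV B))
                               (app (var (there here)) (app (cl (invV A)) (var here)))))
    θV (U X)    = subst (λ W → Tm [] nothing ((W ⊸ ct (ct X)) t→ U X)) (sym RI)
                    (lam (lapp (cl (θC X)) (lapp (var here) top)))
    θV (X ⊸ Y)  = lam (llam (lapp (cl (θC Y)) (lapp (var here) (lapp (cl (invC X)) sv))))

    θC : (X : CTy) → Tm [] nothing (ct (ct X) ⊸ X)
    θC (ccon n) = subst (λ W → Tm [] nothing (W ⊸ ccon n)) (sym (conCC n)) (llam sv)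
    θC c1       = llam cunit
    θC (X & Y)  = llam (cpair (lapp (cl (θC X)) (cfst sv)) (lapp (cl (θC Y)) (csnd sv)))
    θC (A ⇒ Y)  = llam (clam (lapp (cl (θC Y)) (capp sv (app (cl (invV A)) (var here)))))
    θC cI       = subst (λ W → Tm [] nothing (W ⊸ cI)) (sym RI) (llam sv)
    θC (! A)    = subst (λ W → Tm [] nothing ((vt (vt A) !⊗ W) ⊸ ! A)) (sym RI)
                    (llam (lettens sv (lettop sv (bang (app (cl (θV A)) (var here))))))
    θC (A !⊗ Y) = llam (lettens sv (tens (app (cl (θV A)) (var here)) (lapp (cl (θC Y)) sv)))
    θC c0       = llam sv
    θC (X ⊕ Y)  = llam (case sv (inl (lapp (cl (θC X)) sv)) (inr (lapp (cl (θC Y)) sv)))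

  _≋[]_ : {TT : VTy} → Tm [] nothing TT → Tm [] nothing TT → Set
  t ≋[] u = t ≋ u

  record AreInverses : Set where
    field
      θ∘inv  : (A : VTy) → lam (app (cl (θV A)) (app (cl (invV A)) (var here))) ≋[] lam (var here)
      inv∘θ  : (A : VTy) → lam (app (cl (invV A)) (app (cl (θV A)) (var here))) ≋[] lam (var here)
      θ∘invC : (X : CTy) → llam (lapp (cl (θC X)) (lapp (cl (invC X)) sv)) ≋[] llam sv
      invC∘θ : (X : CTy) → llam (lapp (cl (invC X)) (lapp (cl (θC X)) sv)) ≋[] llam sv

  θsub : (Γ : Ctx) → Sub (ctx (ctx Γ)) Γ
  θsub (C ∷ Γ) here      = app (cl (invV C)) (var here)
  θsub (C ∷ Γ) (there x) = wk (θsub Γ x)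

-- We prove, by one simultaneous induction over intrinsically typed terms, two invariants:
--   ValueThm t :  t = (θ_A t••)[θ⁻¹(Γ)]                       for Γ | - ⊢ t : A,
--   CompThm  t :  t = θ̲_B{ t°°[θ⁻¹(Γ)][θ̲⁻¹{z} / k] }           for Γ | Δ ⊢ t : B̲, any stoup Δ.
-- For an empty stoup, t°° is read as t•• applied to the stoup variable and ⊤ : R̲° ≅ I̲ is
-- substituted for it (`tr²`, `tr²θ`); treating both stoups alike makes every term former a
-- single case.  At computation types the two invariants agree (θ_{B̲} h = θ̲_B{h{⊤}}), which is
-- how the two inductions feed each other.  Part (2) of the theorem is CompThm at a nonempty stoup.

module Submission where

open import Defs
open import Data.List using ([]; _∷_)
open import Data.Maybe using (just; nothing)
open import Data.Product using (_×_; _,_)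
open import Relation.Binary.Bundles using (Setoid)
open import Relation.Binary.PropositionalEquality using (_≡_; refl; sym; trans; cong; cong₂; subst)

cong₃ : ∀ {a b c d} {P : Set a} {Q : Set b} {S : Set c} {T : Set d} (f : P → Q → S → T)
        {x x' y y' z z'} → x ≡ x' → y ≡ y' → z ≡ z' → f x y z ≡ f x' y' z'
cong₃ f refl refl refl = refl

-- Each fusion law
-- is stated for any third map agreeing pointwise with the composite, so that it can be used
-- without function extensionality.
ext-ren-ren : {Γ₁ Γ₂ Γ₃ : Ctx} {ρ₁ : Ren Γ₁ Γ₂} {ρ₂ : Ren Γ₂ Γ₃} {ρ₃ : Ren Γ₁ Γ₃}
            → (∀ {A} (x : Γ₁ ∋ A) → ρ₂ (ρ₁ x) ≡ ρ₃ x)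
            → ∀ {A} (x : (B ∷ Γ₁) ∋ A) → ext ρ₂ (ext ρ₁ x) ≡ ext ρ₃ x
ext-ren-ren h here      = refl
ext-ren-ren h (there x) = cong there (h x)

ren-ren : {Γ₁ Γ₂ Γ₃ : Ctx} {ρ₁ : Ren Γ₁ Γ₂} {ρ₂ : Ren Γ₂ Γ₃} {ρ₃ : Ren Γ₁ Γ₃}
        → (∀ {A} (x : Γ₁ ∋ A) → ρ₂ (ρ₁ x) ≡ ρ₃ x)
        → (t : Tm Γ₁ Δ TT) → ren ρ₂ (ren ρ₁ t) ≡ ren ρ₃ t
ren-ren h (var x) = cong var (h x)
ren-ren h unit = refl
ren-ren h (pair a b) = cong₂ pair (ren-ren h a) (ren-ren h b)
ren-ren h (fst a) = cong fst (ren-ren h a)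
ren-ren h (snd a) = cong snd (ren-ren h a)
ren-ren h (lam a) = cong lam (ren-ren (ext-ren-ren h) a)
ren-ren h (app a b) = cong₂ app (ren-ren h a) (ren-ren h b)
ren-ren h sv = refl
ren-ren h cunit = refl
ren-ren h (cpair a b) = cong₂ cpair (ren-ren h a) (ren-ren h b)
ren-ren h (cfst a) = cong cfst (ren-ren h a)
ren-ren h (csnd a) = cong csnd (ren-ren h a)
ren-ren h (clam a) = cong clam (ren-ren (ext-ren-ren h) a)
ren-ren h (capp a b) = cong₂ capp (ren-ren h a) (ren-ren h b)
ren-ren h top = refl
ren-ren h (lettop a b) = cong₂ lettop (ren-ren h a) (ren-ren h b)
ren-ren h (bang a) = cong bang (ren-ren h a)
ren-ren h (letbang a b) = cong₂ letbang (ren-ren h a) (ren-ren (ext-ren-ren h) b)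
ren-ren h (tens a b) = cong₂ tens (ren-ren h a) (ren-ren h b)
ren-ren h (lettens a b) = cong₂ lettens (ren-ren h a) (ren-ren (ext-ren-ren h) b)
ren-ren h (abort a) = cong abort (ren-ren h a)
ren-ren h (inl a) = cong inl (ren-ren h a)
ren-ren h (inr a) = cong inr (ren-ren h a)
ren-ren h (case a b c) = cong₃ case (ren-ren h a) (ren-ren h b) (ren-ren h c)
ren-ren h (llam a) = cong llam (ren-ren h a)
ren-ren h (lapp a b) = cong₂ lapp (ren-ren h a) (ren-ren h b)


wk-ren : (ρ : Ren Γ Γ') (s : Tm Γ Δ TT) → ren (ext {B = B} ρ) (wk s) ≡ wk (ren ρ s)
wk-ren ρ s = trans (ren-ren (λ _ → refl) s) (sym (ren-ren (λ _ → refl) s))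

exts-ren-sub : {Γ₁ Γ₂ Γ₃ : Ctx} {σ : Sub Γ₁ Γ₂} {ρ : Ren Γ₂ Γ₃} {σ' : Sub Γ₁ Γ₃}
             → (∀ {A} (x : Γ₁ ∋ A) → ren ρ (σ x) ≡ σ' x)
             → ∀ {A} (x : (B ∷ Γ₁) ∋ A) → ren (ext ρ) (exts σ x) ≡ exts σ' x
exts-ren-sub h here = refl
exts-ren-sub {σ = σ} {ρ = ρ} h (there x) = trans (wk-ren ρ (σ x)) (cong wk (h x))

ren-sub : {Γ₁ Γ₂ Γ₃ : Ctx} {σ : Sub Γ₁ Γ₂} {ρ : Ren Γ₂ Γ₃} {σ' : Sub Γ₁ Γ₃}
        → (∀ {A} (x : Γ₁ ∋ A) → ren ρ (σ x) ≡ σ' x)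
        → (t : Tm Γ₁ Δ TT) → ren ρ (sub σ t) ≡ sub σ' t
ren-sub h (var x) = h x
ren-sub h unit = refl
ren-sub h (pair a b) = cong₂ pair (ren-sub h a) (ren-sub h b)
ren-sub h (fst a) = cong fst (ren-sub h a)
ren-sub h (snd a) = cong snd (ren-sub h a)
ren-sub h (lam a) = cong lam (ren-sub (exts-ren-sub h) a)
ren-sub h (app a b) = cong₂ app (ren-sub h a) (ren-sub h b)
ren-sub h sv = refl
ren-sub h cunit = refl
ren-sub h (cpair a b) = cong₂ cpair (ren-sub h a) (ren-sub h b)
ren-sub h (cfst a) = cong cfst (ren-sub h a)
ren-sub h (csnd a) = cong csnd (ren-sub h a)
ren-sub h (clam a) = cong clam (ren-sub (exts-ren-sub h) a)
ren-sub h (capp a b) = cong₂ capp (ren-sub h a) (ren-sub h b)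
ren-sub h top = refl
ren-sub h (lettop a b) = cong₂ lettop (ren-sub h a) (ren-sub h b)
ren-sub h (bang a) = cong bang (ren-sub h a)
ren-sub h (letbang a b) = cong₂ letbang (ren-sub h a) (ren-sub (exts-ren-sub h) b)
ren-sub h (tens a b) = cong₂ tens (ren-sub h a) (ren-sub h b)
ren-sub h (lettens a b) = cong₂ lettens (ren-sub h a) (ren-sub (exts-ren-sub h) b)
ren-sub h (abort a) = cong abort (ren-sub h a)
ren-sub h (inl a) = cong inl (ren-sub h a)
ren-sub h (inr a) = cong inr (ren-sub h a)
ren-sub h (case a b c) = cong₃ case (ren-sub h a) (ren-sub h b) (ren-sub h c)
ren-sub h (llam a) = cong llam (ren-sub h a)
ren-sub h (lapp a b) = cong₂ lapp (ren-sub h a) (ren-sub h b)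

exts-sub-ren : {Γ₁ Γ₂ Γ₃ : Ctx} {ρ : Ren Γ₁ Γ₂} {σ : Sub Γ₂ Γ₃} {σ' : Sub Γ₁ Γ₃}
             → (∀ {A} (x : Γ₁ ∋ A) → σ (ρ x) ≡ σ' x)
             → ∀ {A} (x : (B ∷ Γ₁) ∋ A) → exts σ (ext ρ x) ≡ exts σ' x
exts-sub-ren h here = refl
exts-sub-ren h (there x) = cong wk (h x)

sub-ren : {Γ₁ Γ₂ Γ₃ : Ctx} {ρ : Ren Γ₁ Γ₂} {σ : Sub Γ₂ Γ₃} {σ' : Sub Γ₁ Γ₃}
        → (∀ {A} (x : Γ₁ ∋ A) → σ (ρ x) ≡ σ' x)
        → (t : Tm Γ₁ Δ TT) → sub σ (ren ρ t) ≡ sub σ' t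
sub-ren h (var x) = h x
sub-ren h unit = refl
sub-ren h (pair a b) = cong₂ pair (sub-ren h a) (sub-ren h b)
sub-ren h (fst a) = cong fst (sub-ren h a)
sub-ren h (snd a) = cong snd (sub-ren h a)
sub-ren h (lam a) = cong lam (sub-ren (exts-sub-ren h) a)
sub-ren h (app a b) = cong₂ app (sub-ren h a) (sub-ren h b)
sub-ren h sv = refl
sub-ren h cunit = refl
sub-ren h (cpair a b) = cong₂ cpair (sub-ren h a) (sub-ren h b)
sub-ren h (cfst a) = cong cfst (sub-ren h a)
sub-ren h (csnd a) = cong csnd (sub-ren h a)
sub-ren h (clam a) = cong clam (sub-ren (exts-sub-ren h) a)
sub-ren h (capp a b) = cong₂ capp (sub-ren h a) (sub-ren h b)
sub-ren h top = refl
sub-ren h (lettop a b) = cong₂ lettop (sub-ren h a) (sub-ren h b)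
sub-ren h (bang a) = cong bang (sub-ren h a)
sub-ren h (letbang a b) = cong₂ letbang (sub-ren h a) (sub-ren (exts-sub-ren h) b)
sub-ren h (tens a b) = cong₂ tens (sub-ren h a) (sub-ren h b)
sub-ren h (lettens a b) = cong₂ lettens (sub-ren h a) (sub-ren (exts-sub-ren h) b)
sub-ren h (abort a) = cong abort (sub-ren h a)
sub-ren h (inl a) = cong inl (sub-ren h a)
sub-ren h (inr a) = cong inr (sub-ren h a)
sub-ren h (case a b c) = cong₃ case (sub-ren h a) (sub-ren h b) (sub-ren h c)
sub-ren h (llam a) = cong llam (sub-ren h a)
sub-ren h (lapp a b) = cong₂ lapp (sub-ren h a) (sub-ren h b)

wk-sub : (σ : Sub Γ Γ') (s : Tm Γ Δ TT) → sub (exts {B = B} σ) (wk s) ≡ wk (sub σ s)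
wk-sub σ s = trans (sub-ren (λ _ → refl) s) (sym (ren-sub (λ _ → refl) s))

exts-sub-sub : {Γ₁ Γ₂ Γ₃ : Ctx} {σ₁ : Sub Γ₁ Γ₂} {σ₂ : Sub Γ₂ Γ₃} {σ₃ : Sub Γ₁ Γ₃}
             → (∀ {A} (x : Γ₁ ∋ A) → sub σ₂ (σ₁ x) ≡ σ₃ x)
             → ∀ {A} (x : (B ∷ Γ₁) ∋ A) → sub (exts σ₂) (exts σ₁ x) ≡ exts σ₃ x
exts-sub-sub h here = refl
exts-sub-sub {σ₁ = σ₁} {σ₂ = σ₂} h (there x) = trans (wk-sub σ₂ (σ₁ x)) (cong wk (h x))

sub-sub : {Γ₁ Γ₂ Γ₃ : Ctx} {σ₁ : Sub Γ₁ Γ₂} {σ₂ : Sub Γ₂ Γ₃} {σ₃ : Sub Γ₁ Γ₃}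
        → (∀ {A} (x : Γ₁ ∋ A) → sub σ₂ (σ₁ x) ≡ σ₃ x)
        → (t : Tm Γ₁ Δ TT) → sub σ₂ (sub σ₁ t) ≡ sub σ₃ t
sub-sub h (var x) = h x
sub-sub h unit = refl
sub-sub h (pair a b) = cong₂ pair (sub-sub h a) (sub-sub h b)
sub-sub h (fst a) = cong fst (sub-sub h a)
sub-sub h (snd a) = cong snd (sub-sub h a)
sub-sub h (lam a) = cong lam (sub-sub (exts-sub-sub h) a)
sub-sub h (app a b) = cong₂ app (sub-sub h a) (sub-sub h b)
sub-sub h sv = refl
sub-sub h cunit = refl
sub-sub h (cpair a b) = cong₂ cpair (sub-sub h a) (sub-sub h b)
sub-sub h (cfst a) = cong cfst (sub-sub h a)
sub-sub h (csnd a) = cong csnd (sub-sub h a)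
sub-sub h (clam a) = cong clam (sub-sub (exts-sub-sub h) a)
sub-sub h (capp a b) = cong₂ capp (sub-sub h a) (sub-sub h b)
sub-sub h top = refl
sub-sub h (lettop a b) = cong₂ lettop (sub-sub h a) (sub-sub h b)
sub-sub h (bang a) = cong bang (sub-sub h a)
sub-sub h (letbang a b) = cong₂ letbang (sub-sub h a) (sub-sub (exts-sub-sub h) b)
sub-sub h (tens a b) = cong₂ tens (sub-sub h a) (sub-sub h b)
sub-sub h (lettens a b) = cong₂ lettens (sub-sub h a) (sub-sub (exts-sub-sub h) b)
sub-sub h (abort a) = cong abort (sub-sub h a)
sub-sub h (inl a) = cong inl (sub-sub h a)
sub-sub h (inr a) = cong inr (sub-sub h a)
sub-sub h (case a b c) = cong₃ case (sub-sub h a) (sub-sub h b) (sub-sub h c)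
sub-sub h (llam a) = cong llam (sub-sub h a)
sub-sub h (lapp a b) = cong₂ lapp (sub-sub h a) (sub-sub h b)

exts-id : {σ : Sub Γ Γ} → (∀ {A} (x : Γ ∋ A) → σ x ≡ var x)
        → ∀ {A} (x : (B ∷ Γ) ∋ A) → exts σ x ≡ var x
exts-id h here = refl
exts-id h (there x) = cong wk (h x)

sub-id : {σ : Sub Γ Γ} → (∀ {A} (x : Γ ∋ A) → σ x ≡ var x)
       → (t : Tm Γ Δ TT) → sub σ t ≡ t
sub-id h (var x) = h x
sub-id h unit = refl
sub-id h (pair a b) = cong₂ pair (sub-id h a) (sub-id h b)
sub-id h (fst a) = cong fst (sub-id h a)
sub-id h (snd a) = cong snd (sub-id h a)
sub-id h (lam a) = cong lam (sub-id (exts-id h) a)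
sub-id h (app a b) = cong₂ app (sub-id h a) (sub-id h b)
sub-id h sv = refl
sub-id h cunit = refl
sub-id h (cpair a b) = cong₂ cpair (sub-id h a) (sub-id h b)
sub-id h (cfst a) = cong cfst (sub-id h a)
sub-id h (csnd a) = cong csnd (sub-id h a)
sub-id h (clam a) = cong clam (sub-id (exts-id h) a)
sub-id h (capp a b) = cong₂ capp (sub-id h a) (sub-id h b)
sub-id h top = refl
sub-id h (lettop a b) = cong₂ lettop (sub-id h a) (sub-id h b)
sub-id h (bang a) = cong bang (sub-id h a)
sub-id h (letbang a b) = cong₂ letbang (sub-id h a) (sub-id (exts-id h) b)
sub-id h (tens a b) = cong₂ tens (sub-id h a) (sub-id h b)
sub-id h (lettens a b) = cong₂ lettens (sub-id h a) (sub-id (exts-id h) b)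
sub-id h (abort a) = cong abort (sub-id h a)
sub-id h (inl a) = cong inl (sub-id h a)
sub-id h (inr a) = cong inr (sub-id h a)
sub-id h (case a b c) = cong₃ case (sub-id h a) (sub-id h b) (sub-id h c)
sub-id h (llam a) = cong llam (sub-id h a)
sub-id h (lapp a b) = cong₂ lapp (sub-id h a) (sub-id h b)


ren-as-sub : {ρ : Ren Γ Γ'} {σ : Sub Γ Γ'} → (∀ {A} (x : Γ ∋ A) → σ x ≡ var (ρ x))
           → (t : Tm Γ Δ TT) → ren ρ t ≡ sub σ t
ren-as-sub h t = trans (sym (sub-id (λ _ → refl) (ren _ t))) (sub-ren (λ x → sym (h x)) t)

ren-cl : (ρ : Ren Γ Γ') (t : Tm [] Δ TT) → ren ρ (cl t) ≡ cl t
ren-cl ρ t = ren-ren (λ ()) t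

sub-cl : (σ : Sub Γ Γ') (t : Tm [] Δ TT) → sub σ (cl t) ≡ cl t
sub-cl σ t = trans (sub-ren {σ' = λ ()} (λ ()) t) (sym (ren-as-sub (λ ()) t))

sub-single : (σ : Sub Γ Γ') (t : Tm (A ∷ Γ) Δ TT) (u : Tm Γ nothing A)
           → sub σ (t [ u ]) ≡ (sub (exts σ) t) [ sub σ u ]
sub-single {Γ = Γ} {A = A} σ t u =
  trans (sub-sub {σ₃ = λ x → sub σ (var x [ u ])} (λ _ → refl) t) (sym (sub-sub h t))
  where
  h : ∀ {C} (x : (A ∷ Γ) ∋ C) → (exts σ x) [ sub σ u ] ≡ sub σ (var x [ u ])
  h here      = refl
  h (there x) = trans (sub-ren (λ _ → refl) (σ x)) (sub-id (λ _ → refl) (σ x))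

wk-single : (t : Tm Γ Δ TT) (u : Tm Γ nothing A) → (wk t) [ u ] ≡ t
wk-single t u = trans (sub-ren (λ _ → refl) t) (sub-id (λ _ → refl) t)

ren-ssub : (ρ : Ren Γ Γ') (t : Tm Γ (just X) TT) (s : Tm Γ Δ (U X))
         → ren ρ (ssub t s) ≡ ssub (ren ρ t) (ren ρ s)
ren-ssub ρ sv            s = refl
ren-ssub ρ cunit         s = refl
ren-ssub ρ (cpair a b)   s = cong₂ cpair (ren-ssub ρ a s) (ren-ssub ρ b s)
ren-ssub ρ (cfst a)      s = cong cfst (ren-ssub ρ a s)
ren-ssub ρ (csnd a)      s = cong csnd (ren-ssub ρ a s)
ren-ssub ρ (clam a)      s =
  cong clam (trans (ren-ssub (ext ρ) a (wk s)) (cong (ssub (ren (ext ρ) a)) (wk-ren ρ s)))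
ren-ssub ρ (capp a b)    s = cong (λ z → capp z _) (ren-ssub ρ a s)
ren-ssub ρ (lettop a b)  s = cong (λ z → lettop z _) (ren-ssub ρ a s)
ren-ssub ρ (letbang a b) s = cong (λ z → letbang z _) (ren-ssub ρ a s)
ren-ssub ρ (tens a b)    s = cong (tens _) (ren-ssub ρ b s)
ren-ssub ρ (lettens a b) s = cong (λ z → lettens z _) (ren-ssub ρ a s)
ren-ssub ρ (abort a)     s = cong abort (ren-ssub ρ a s)
ren-ssub ρ (inl a)       s = cong inl (ren-ssub ρ a s)
ren-ssub ρ (inr a)       s = cong inr (ren-ssub ρ a s)
ren-ssub ρ (case a b c)  s = cong (λ z → case z _ _) (ren-ssub ρ a s)
ren-ssub ρ (lapp a b)    s = cong (lapp _) (ren-ssub ρ b s)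

sub-ssub : (σ : Sub Γ Γ') (t : Tm Γ (just X) TT) (s : Tm Γ Δ (U X))
         → sub σ (ssub t s) ≡ ssub (sub σ t) (sub σ s)
sub-ssub σ sv            s = refl
sub-ssub σ cunit         s = refl
sub-ssub σ (cpair a b)   s = cong₂ cpair (sub-ssub σ a s) (sub-ssub σ b s)
sub-ssub σ (cfst a)      s = cong cfst (sub-ssub σ a s)
sub-ssub σ (csnd a)      s = cong csnd (sub-ssub σ a s)
sub-ssub σ (clam a)      s =
  cong clam (trans (sub-ssub (exts σ) a (wk s)) (cong (ssub (sub (exts σ) a)) (wk-sub σ s)))
sub-ssub σ (capp a b)    s = cong (λ z → capp z _) (sub-ssub σ a s)
sub-ssub σ (lettop a b)  s = cong (λ z → lettop z _) (sub-ssub σ a s)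
sub-ssub σ (letbang a b) s = cong (λ z → letbang z _) (sub-ssub σ a s)
sub-ssub σ (tens a b)    s = cong (tens _) (sub-ssub σ b s)
sub-ssub σ (lettens a b) s = cong (λ z → lettens z _) (sub-ssub σ a s)
sub-ssub σ (abort a)     s = cong abort (sub-ssub σ a s)
sub-ssub σ (inl a)       s = cong inl (sub-ssub σ a s)
sub-ssub σ (inr a)       s = cong inr (sub-ssub σ a s)
sub-ssub σ (case a b c)  s = cong (λ z → case z _ _) (sub-ssub σ a s)
sub-ssub σ (lapp a b)    s = cong (lapp _) (sub-ssub σ b s)

ssub-sv : (t : Tm Γ (just X) TT) → ssub t sv ≡ t
ssub-sv sv            = refl
ssub-sv cunit         = refl
ssub-sv (cpair a b)   = cong₂ cpair (ssub-sv a) (ssub-sv b)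
ssub-sv (cfst a)      = cong cfst (ssub-sv a)
ssub-sv (csnd a)      = cong csnd (ssub-sv a)
ssub-sv (clam a)      = cong clam (ssub-sv a)
ssub-sv (capp a b)    = cong (λ z → capp z _) (ssub-sv a)
ssub-sv (lettop a b)  = cong (λ z → lettop z _) (ssub-sv a)
ssub-sv (letbang a b) = cong (λ z → letbang z _) (ssub-sv a)
ssub-sv (tens a b)    = cong (tens _) (ssub-sv b)
ssub-sv (lettens a b) = cong (λ z → lettens z _) (ssub-sv a)
ssub-sv (abort a)     = cong abort (ssub-sv a)
ssub-sv (inl a)       = cong inl (ssub-sv a)
ssub-sv (inr a)       = cong inr (ssub-sv a)
ssub-sv (case a b c)  = cong (λ z → case z _ _) (ssub-sv a)
ssub-sv (lapp a b)    = cong (lapp _) (ssub-sv b)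

ssub-assoc : (t : Tm Γ (just X) TT) (s : Tm Γ (just Y) (U X)) (r : Tm Γ Δ (U Y))
           → ssub (ssub t s) r ≡ ssub t (ssub s r)
ssub-assoc sv            s r = refl
ssub-assoc cunit         s r = refl
ssub-assoc (cpair a b)   s r = cong₂ cpair (ssub-assoc a s r) (ssub-assoc b s r)
ssub-assoc (cfst a)      s r = cong cfst (ssub-assoc a s r)
ssub-assoc (csnd a)      s r = cong csnd (ssub-assoc a s r)
ssub-assoc (clam a)      s r =
  cong clam (trans (ssub-assoc a (wk s) (wk r)) (cong (ssub a) (sym (ren-ssub there s r))))
ssub-assoc (capp a b)    s r = cong (λ z → capp z _) (ssub-assoc a s r)
ssub-assoc (lettop a b)  s r = cong (λ z → lettop z _) (ssub-assoc a s r)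
ssub-assoc (letbang a b) s r = cong (λ z → letbang z _) (ssub-assoc a s r)
ssub-assoc (tens a b)    s r = cong (tens _) (ssub-assoc b s r)
ssub-assoc (lettens a b) s r = cong (λ z → lettens z _) (ssub-assoc a s r)
ssub-assoc (abort a)     s r = cong abort (ssub-assoc a s r)
ssub-assoc (inl a)       s r = cong inl (ssub-assoc a s r)
ssub-assoc (inr a)       s r = cong inr (ssub-assoc a s r)
ssub-assoc (case a b c)  s r = cong (λ z → case z _ _) (ssub-assoc a s r)
ssub-assoc (lapp a b)    s r = cong (lapp _) (ssub-assoc b s r)

≡→≋ : {t u : Tm Γ Δ TT} → t ≡ u → t ≋ u
≡→≋ refl = ≋-refl

≋-setoid : (Γ : Ctx) (Δ : Stoup) (TT : VTy) → Setoid _ _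
≋-setoid Γ Δ TT = record
  { Carrier       = Tm Γ Δ TT
  ; _≈_           = _≋_
  ; isEquivalence = record { refl = ≋-refl ; sym = ≋-sym ; trans = ≋-trans }
  }

module ≋-Reasoning {Γ : Ctx} {Δ : Stoup} {TT : VTy} where
  open import Relation.Binary.Reasoning.Setoid (≋-setoid Γ Δ TT) public

-- an axiom instance whose sides agree with the wanted ones only up to ≡
≋-rw : {a a' b b' : Tm Γ Δ TT} → a ≡ a' → b ≡ b' → a' ≋ b' → a ≋ b
≋-rw refl refl p = p

≋-sub : (σ : Sub Γ Γ') {t u : Tm Γ Δ TT} → t ≋ u → sub σ t ≋ sub σ u
≋-sub σ ≋-refl = ≋-refl
≋-sub σ (≋-sym p) = ≋-sym (≋-sub σ p)
≋-sub σ (≋-trans p q) = ≋-trans (≋-sub σ p) (≋-sub σ q)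
≋-sub σ (≋-pair p q) = ≋-pair (≋-sub σ p) (≋-sub σ q)
≋-sub σ (≋-fst p) = ≋-fst (≋-sub σ p)
≋-sub σ (≋-snd p) = ≋-snd (≋-sub σ p)
≋-sub σ (≋-lam p) = ≋-lam (≋-sub (exts σ) p)
≋-sub σ (≋-app p q) = ≋-app (≋-sub σ p) (≋-sub σ q)
≋-sub σ (≋-cpair p q) = ≋-cpair (≋-sub σ p) (≋-sub σ q)
≋-sub σ (≋-cfst p) = ≋-cfst (≋-sub σ p)
≋-sub σ (≋-csnd p) = ≋-csnd (≋-sub σ p)
≋-sub σ (≋-clam p) = ≋-clam (≋-sub (exts σ) p)
≋-sub σ (≋-capp p q) = ≋-capp (≋-sub σ p) (≋-sub σ q)
≋-sub σ (≋-lettop p q) = ≋-lettop (≋-sub σ p) (≋-sub σ q)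
≋-sub σ (≋-bang p) = ≋-bang (≋-sub σ p)
≋-sub σ (≋-letbang p q) = ≋-letbang (≋-sub σ p) (≋-sub (exts σ) q)
≋-sub σ (≋-tens p q) = ≋-tens (≋-sub σ p) (≋-sub σ q)
≋-sub σ (≋-lettens p q) = ≋-lettens (≋-sub σ p) (≋-sub (exts σ) q)
≋-sub σ (≋-abort p) = ≋-abort (≋-sub σ p)
≋-sub σ (≋-inl p) = ≋-inl (≋-sub σ p)
≋-sub σ (≋-inr p) = ≋-inr (≋-sub σ p)
≋-sub σ (≋-case p q r) = ≋-case (≋-sub σ p) (≋-sub σ q) (≋-sub σ r)
≋-sub σ (≋-llam p) = ≋-llam (≋-sub σ p)
≋-sub σ (≋-lapp p q) = ≋-lapp (≋-sub σ p) (≋-sub σ q)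
≋-sub σ (η-1 t) = η-1 _
≋-sub σ (β-×₁ t u) = β-×₁ _ _
≋-sub σ (β-×₂ t u) = β-×₂ _ _
≋-sub σ (η-× t) = η-× _
≋-sub σ (β-→ t u) = ≋-rw refl (sub-single σ t u) (β-→ _ _)
≋-sub σ (η-→ t) = ≋-rw (cong (λ z → lam (app z (var here))) (wk-sub σ t)) refl (η-→ _)
≋-sub σ (η-1̲ t) = η-1̲ _
≋-sub σ (β-&₁ t u) = β-&₁ _ _
≋-sub σ (β-&₂ t u) = β-&₂ _ _
≋-sub σ (η-& t) = η-& _
≋-sub σ (β-⇒ t u) = ≋-rw refl (sub-single σ t u) (β-⇒ _ _)
≋-sub σ (η-⇒ t) = ≋-rw (cong (λ z → clam (capp z (var here))) (wk-sub σ t)) refl (η-⇒ _)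
≋-sub σ (β-I t) = β-I _
≋-sub σ (η-I u t) = ≋-rw (cong (lettop (sub σ t)) (sub-ssub σ u top)) (sub-ssub σ u t) (η-I _ _)
≋-sub σ (β-! t u) = ≋-rw refl (sub-single σ u t) (β-! _ _)
≋-sub σ (η-! u t) =
  ≋-rw (cong (letbang (sub σ t))
         (trans (sub-ssub (exts σ) (wk u) (bang (var here)))
                (cong (λ z → ssub z (bang (var here))) (wk-sub σ u))))
       (sub-ssub σ u t) (η-! _ _)
≋-sub σ (β-⊗ t s u) =
  ≋-rw refl (trans (sub-ssub σ (u [ t ]) s) (cong (λ z → ssub z (sub σ s)) (sub-single σ u t)))
       (β-⊗ _ _ _)
≋-sub σ (η-⊗ u t) =
  ≋-rw (cong (lettens (sub σ t))
         (trans (sub-ssub (exts σ) (wk u) (tens (var here) sv))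
                (cong (λ z → ssub z (tens (var here) sv)) (wk-sub σ u))))
       (sub-ssub σ u t) (η-⊗ _ _)
≋-sub σ (η-0 u t) = ≋-rw refl (sub-ssub σ u t) (η-0 _ _)
≋-sub σ (β-⊕₁ t u u') = ≋-rw refl (sub-ssub σ u t) (β-⊕₁ _ _ _)
≋-sub σ (β-⊕₂ t u u') = ≋-rw refl (sub-ssub σ u' t) (β-⊕₂ _ _ _)
≋-sub σ (η-⊕ u t) =
  ≋-rw (cong₂ (case (sub σ t)) (sub-ssub σ u (inl sv)) (sub-ssub σ u (inr sv)))
       (sub-ssub σ u t) (η-⊕ _ _)
≋-sub σ (β-⊸ t u) = ≋-rw refl (sub-ssub σ t u) (β-⊸ _ _)
≋-sub σ (η-⊸ t) = η-⊸ _

≋-ren : (ρ : Ren Γ Γ') {t u : Tm Γ Δ TT} → t ≋ u → ren ρ t ≋ ren ρ u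
≋-ren ρ {t} {u} p =
  ≋-rw (ren-as-sub (λ _ → refl) t) (ren-as-sub (λ _ → refl) u) (≋-sub (λ x → var (ρ x)) p)

exts-≋ : {σ σ' : Sub Γ Γ'} → (∀ {A} (x : Γ ∋ A) → σ x ≋ σ' x)
       → ∀ {A} (x : (B ∷ Γ) ∋ A) → exts σ x ≋ exts σ' x
exts-≋ h here      = ≋-refl
exts-≋ h (there x) = ≋-ren there (h x)

sub-≋ : {σ σ' : Sub Γ Γ'} → (∀ {A} (x : Γ ∋ A) → σ x ≋ σ' x)
      → (t : Tm Γ Δ TT) → sub σ t ≋ sub σ' t
sub-≋ h (var x) = h x
sub-≋ h unit = ≋-refl
sub-≋ h (pair a b) = ≋-pair (sub-≋ h a) (sub-≋ h b)
sub-≋ h (fst a) = ≋-fst (sub-≋ h a)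
sub-≋ h (snd a) = ≋-snd (sub-≋ h a)
sub-≋ h (lam a) = ≋-lam (sub-≋ (exts-≋ h) a)
sub-≋ h (app a b) = ≋-app (sub-≋ h a) (sub-≋ h b)
sub-≋ h sv = ≋-refl
sub-≋ h cunit = ≋-refl
sub-≋ h (cpair a b) = ≋-cpair (sub-≋ h a) (sub-≋ h b)
sub-≋ h (cfst a) = ≋-cfst (sub-≋ h a)
sub-≋ h (csnd a) = ≋-csnd (sub-≋ h a)
sub-≋ h (clam a) = ≋-clam (sub-≋ (exts-≋ h) a)
sub-≋ h (capp a b) = ≋-capp (sub-≋ h a) (sub-≋ h b)
sub-≋ h top = ≋-refl
sub-≋ h (lettop a b) = ≋-lettop (sub-≋ h a) (sub-≋ h b)
sub-≋ h (bang a) = ≋-bang (sub-≋ h a)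
sub-≋ h (letbang a b) = ≋-letbang (sub-≋ h a) (sub-≋ (exts-≋ h) b)
sub-≋ h (tens a b) = ≋-tens (sub-≋ h a) (sub-≋ h b)
sub-≋ h (lettens a b) = ≋-lettens (sub-≋ h a) (sub-≋ (exts-≋ h) b)
sub-≋ h (abort a) = ≋-abort (sub-≋ h a)
sub-≋ h (inl a) = ≋-inl (sub-≋ h a)
sub-≋ h (inr a) = ≋-inr (sub-≋ h a)
sub-≋ h (case a b c) = ≋-case (sub-≋ h a) (sub-≋ h b) (sub-≋ h c)
sub-≋ h (llam a) = ≋-llam (sub-≋ h a)
sub-≋ h (lapp a b) = ≋-lapp (sub-≋ h a) (sub-≋ h b)

≋-ssub₁ : {t t' : Tm Γ (just X) TT} → t ≋ t' → (s : Tm Γ Δ (U X)) → ssub t s ≋ ssub t' s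
≋-ssub₁ ≋-refl s = ≋-refl
≋-ssub₁ (≋-sym p) s = ≋-sym (≋-ssub₁ p s)
≋-ssub₁ (≋-trans p q) s = ≋-trans (≋-ssub₁ p s) (≋-ssub₁ q s)
≋-ssub₁ (≋-cpair p q) s = ≋-cpair (≋-ssub₁ p s) (≋-ssub₁ q s)
≋-ssub₁ (≋-cfst p) s = ≋-cfst (≋-ssub₁ p s)
≋-ssub₁ (≋-csnd p) s = ≋-csnd (≋-ssub₁ p s)
≋-ssub₁ (≋-clam p) s = ≋-clam (≋-ssub₁ p (wk s))
≋-ssub₁ (≋-capp p q) s = ≋-capp (≋-ssub₁ p s) q
≋-ssub₁ (≋-lettop p q) s = ≋-lettop (≋-ssub₁ p s) q
≋-ssub₁ (≋-letbang p q) s = ≋-letbang (≋-ssub₁ p s) q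
≋-ssub₁ (≋-tens p q) s = ≋-tens p (≋-ssub₁ q s)
≋-ssub₁ (≋-lettens p q) s = ≋-lettens (≋-ssub₁ p s) q
≋-ssub₁ (≋-abort p) s = ≋-abort (≋-ssub₁ p s)
≋-ssub₁ (≋-inl p) s = ≋-inl (≋-ssub₁ p s)
≋-ssub₁ (≋-inr p) s = ≋-inr (≋-ssub₁ p s)
≋-ssub₁ (≋-case p q r) s = ≋-case (≋-ssub₁ p s) q r
≋-ssub₁ (≋-lapp p q) s = ≋-lapp p (≋-ssub₁ q s)
≋-ssub₁ (η-1̲ t) s = η-1̲ _
≋-ssub₁ (β-&₁ t u) s = β-&₁ _ _
≋-ssub₁ (β-&₂ t u) s = β-&₂ _ _
≋-ssub₁ (η-& t) s = η-& _
≋-ssub₁ (β-⇒ t u) s =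
  ≋-rw refl (sym (trans (sub-ssub _ t (wk s)) (cong (ssub (t [ u ])) (wk-single s u))))
       (β-⇒ _ _)
≋-ssub₁ (η-⇒ t) s =
  ≋-rw (cong (λ z → clam (capp z (var here))) (sym (ren-ssub there t s))) refl (η-⇒ _)
≋-ssub₁ (η-I u t) s = ≋-rw refl (ssub-assoc u t s) (η-I _ _)
≋-ssub₁ (η-! u t) s = ≋-rw refl (ssub-assoc u t s) (η-! _ _)
≋-ssub₁ (β-⊗ t s' u) s = ≋-rw refl (ssub-assoc (u [ t ]) s' s) (β-⊗ _ _ _)
≋-ssub₁ (η-⊗ u t) s = ≋-rw refl (ssub-assoc u t s) (η-⊗ _ _)
≋-ssub₁ (η-0 u t) s = ≋-rw refl (ssub-assoc u t s) (η-0 u _)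
≋-ssub₁ (β-⊕₁ t u u') s = ≋-rw refl (ssub-assoc u t s) (β-⊕₁ _ _ _)
≋-ssub₁ (β-⊕₂ t u u') s = ≋-rw refl (ssub-assoc u' t s) (β-⊕₂ _ _ _)
≋-ssub₁ (η-⊕ u t) s = ≋-rw refl (ssub-assoc u t s) (η-⊕ _ _)
≋-ssub₁ (β-⊸ t u) s = ≋-rw refl (ssub-assoc t u s) (β-⊸ _ _)

≋-ssub₂ : (t : Tm Γ (just X) TT) {s s' : Tm Γ Δ (U X)} → s ≋ s' → ssub t s ≋ ssub t s'
≋-ssub₂ sv            p = p
≋-ssub₂ cunit         p = ≋-refl
≋-ssub₂ (cpair a b)   p = ≋-cpair (≋-ssub₂ a p) (≋-ssub₂ b p)
≋-ssub₂ (cfst a)      p = ≋-cfst (≋-ssub₂ a p)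
≋-ssub₂ (csnd a)      p = ≋-csnd (≋-ssub₂ a p)
≋-ssub₂ (clam a)      p = ≋-clam (≋-ssub₂ a (≋-ren there p))
≋-ssub₂ (capp a b)    p = ≋-capp (≋-ssub₂ a p) ≋-refl
≋-ssub₂ (lettop a b)  p = ≋-lettop (≋-ssub₂ a p) ≋-refl
≋-ssub₂ (letbang a b) p = ≋-letbang (≋-ssub₂ a p) ≋-refl
≋-ssub₂ (tens a b)    p = ≋-tens ≋-refl (≋-ssub₂ b p)
≋-ssub₂ (lettens a b) p = ≋-lettens (≋-ssub₂ a p) ≋-refl
≋-ssub₂ (abort a)     p = ≋-abort (≋-ssub₂ a p)
≋-ssub₂ (inl a)       p = ≋-inl (≋-ssub₂ a p)
≋-ssub₂ (inr a)       p = ≋-inr (≋-ssub₂ a p)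
≋-ssub₂ (case a b c)  p = ≋-case (≋-ssub₂ a p) ≋-refl ≋-refl
≋-ssub₂ (lapp a b)    p = ≋-lapp ≋-refl (≋-ssub₂ b p)

β-⊸-sv : (t : Tm Γ (just X) (U Y)) → lapp (llam t) sv ≋ t
β-⊸-sv t = ≋-trans (β-⊸ t sv) (≡→≋ (ssub-sv t))

lift-single : (t : Tm (A ∷ Γ) Δ TT) → (ren (ext {B = A} there) t) [ var here ] ≡ t
lift-single t = trans (sub-ren (λ { here → refl ; (there x) → refl }) t) (sub-id (λ _ → refl) t)

ssub-through : {W : CTy} (F : Tm Γ (just Z) (U D)) (E : Tm Γ (just W) (U Z)) (s : Tm Γ Δ (U W))
               {r : Tm Γ Δ (U Z)} → ssub E s ≋ r → ssub (ssub F E) s ≋ ssub F r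
ssub-through F E s p = ≋-trans (≡→≋ (ssub-assoc F E s)) (≋-ssub₂ F p)

-- Commuting conversions: a stoup-linear term F (a term with the stoup variable free) commutes
-- with the eliminators whose principal argument sits in the stoup.  Each follows from the η-law
-- of the eliminated type.
module _ (F : Tm Γ (just Z) (U D)) where
  open ≋-Reasoning

  ssub-case : (a : Tm Γ Δ (U (X ⊕ Y))) (b : Tm Γ (just X) (U Z)) (c : Tm Γ (just Y) (U Z))
            → ssub F (case a b c) ≋ case a (ssub F b) (ssub F c)
  ssub-case a b c = begin
    ssub F (case a b c)                        ≡⟨ ssub-assoc F E a ⟨
    ssub (ssub F E) a                          ≈⟨ η-⊕ (ssub F E) a ⟨
    case a (ssub (ssub F E) (inl sv)) (ssub (ssub F E) (inr sv))
      ≈⟨ ≋-case ≋-refl (ssub-through F E (inl sv) (≋-trans (β-⊕₁ sv b c) (≡→≋ (ssub-sv b))))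
                       (ssub-through F E (inr sv) (≋-trans (β-⊕₂ sv b c) (≡→≋ (ssub-sv c)))) ⟩
    case a (ssub F b) (ssub F c)               ∎
    where E = case sv b c

  ssub-lettens : (a : Tm Γ Δ (U (A !⊗ Y))) (b : Tm (A ∷ Γ) (just Y) (U Z))
               → ssub F (lettens a b) ≋ lettens a (ssub (wk F) b)
  ssub-lettens a b = begin
    ssub F (lettens a b)                                     ≡⟨ ssub-assoc F E a ⟨
    ssub (ssub F E) a                                        ≈⟨ η-⊗ (ssub F E) a ⟨
    lettens a (ssub (wk (ssub F E)) x⊗z)                     ≡⟨ cong (λ G → lettens a (ssub G x⊗z))
                                                                     (ren-ssub there F E) ⟩
    lettens a (ssub (ssub (wk F) (wk E)) x⊗z)                ≈⟨ ≋-lettens ≋-refl (ssub-through (wk F) (wk E) x⊗z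
                                                                  (≋-trans (β-⊗ (var here) sv b') b'-id)) ⟩
    lettens a (ssub (wk F) b)                                ∎
    where
    E   = lettens sv b
    b'  = ren (ext there) b
    x⊗z = tens (var here) sv
    b'-id : ssub (b' [ var here ]) sv ≋ b
    b'-id = ≡→≋ (trans (ssub-sv _) (lift-single b))

  ssub-lettop : (a : Tm Γ Δ (U cI)) (u : Tm Γ nothing (U Z))
              → ssub F (lettop a u) ≋ lettop a (ssub F u)
  ssub-lettop a u = begin
    ssub F (lettop a u)                  ≡⟨ ssub-assoc F E a ⟨
    ssub (ssub F E) a                    ≈⟨ η-I (ssub F E) a ⟨
    lettop a (ssub (ssub F E) top)       ≈⟨ ≋-lettop ≋-refl (ssub-through F E top (β-I u)) ⟩
    lettop a (ssub F u)                  ∎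
    where E = lettop sv u

  ssub-abort : (a : Tm Γ Δ (U c0)) → ssub F (abort a) ≋ abort a
  ssub-abort a = ≋-sym (≋-trans (η-0 (ssub F (abort sv)) a) (≡→≋ (ssub-assoc F (abort sv) a)))

module TranslationLemmas (R : CTy) where
  open Translation R

  ext-tr : {ρ : Ren Γ Γ'} {ρ' : Ren (ctx Γ) (ctx Γ')}
         → (∀ {A} (x : Γ ∋ A) → ρ' (trVar x) ≡ trVar (ρ x))
         → ∀ {A} (x : (B ∷ Γ) ∋ A) → ext ρ' (trVar x) ≡ trVar (ext ρ x)
  ext-tr h here      = refl
  ext-tr h (there x) = cong there (h x)

  mutual
    trV-ren : {ρ : Ren Γ Γ'} {ρ' : Ren (ctx Γ) (ctx Γ')}
            → (∀ {A} (x : Γ ∋ A) → ρ' (trVar x) ≡ trVar (ρ x))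
            → (t : Tm Γ nothing A) → trV (ren ρ t) ≡ ren ρ' (trV t)
    trV-ren h (var x) = cong var (sym (h x))
    trV-ren h unit = refl
    trV-ren h (pair t u) = cong₂ pair (trV-ren h t) (trV-ren h u)
    trV-ren h (fst t) = cong fst (trV-ren h t)
    trV-ren h (snd t) = cong snd (trV-ren h t)
    trV-ren h (lam t) = cong lam (trV-ren (ext-tr h) t)
    trV-ren h (app t u) = cong₂ app (trV-ren h t) (trV-ren h u)
    trV-ren h cunit = refl
    trV-ren h (cpair t u) =
      cong₂ (λ a b → llam (case sv (lapp a sv) (lapp b sv))) (trV-ren h t) (trV-ren h u)
    trV-ren h (cfst t) = cong (λ a → llam (lapp a (inl sv))) (trV-ren h t)
    trV-ren h (csnd t) = cong (λ a → llam (lapp a (inr sv))) (trV-ren h t)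
    trV-ren h (clam t) = cong (λ a → llam (lettens sv (lapp a sv))) (trV-ren (ext-tr h) t)
    trV-ren h (capp s t) = cong₂ (λ a b → llam (lapp a (tens b sv))) (trV-ren h s) (trV-ren h t)
    trV-ren h top = refl
    trV-ren h (lettop t u) = cong₂ (λ a b → llam (lapp a (lapp b sv))) (trV-ren h t) (trV-ren h u)
    trV-ren h (bang t) = cong (λ a → llam (capp sv a)) (trV-ren h t)
    trV-ren h (letbang t u) =
      cong₂ (λ a b → llam (lapp a (clam (lapp b sv)))) (trV-ren h t) (trV-ren (ext-tr h) u)
    trV-ren h (tens t u) = cong₂ (λ a b → llam (lapp b (capp sv a))) (trV-ren h t) (trV-ren h u)
    trV-ren h (lettens s t) =
      cong₂ (λ a b → llam (lapp a (clam b))) (trV-ren h s) (trC-ren (ext-tr h) t)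
    trV-ren h (abort t) = cong (λ a → llam (lapp a cunit)) (trV-ren h t)
    trV-ren h (inl t) = cong (λ a → llam (lapp a (cfst sv))) (trV-ren h t)
    trV-ren h (inr t) = cong (λ a → llam (lapp a (csnd sv))) (trV-ren h t)
    trV-ren h (case s t u) =
      cong₃ (λ a b c → llam (lapp a (cpair b c))) (trV-ren h s) (trC-ren h t) (trC-ren h u)
    trV-ren h (llam t) = cong llam (trC-ren h t)
    trV-ren h (lapp s t) = cong₂ (λ a b → llam (lapp b (lapp a sv))) (trV-ren h s) (trV-ren h t)

    trC-ren : {ρ : Ren Γ Γ'} {ρ' : Ren (ctx Γ) (ctx Γ')}
            → (∀ {A} (x : Γ ∋ A) → ρ' (trVar x) ≡ trVar (ρ x))
            → (t : Tm Γ (just D) (U Y)) → trC (ren ρ t) ≡ ren ρ' (trC t)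
    trC-ren h sv = refl
    trC-ren h cunit = refl
    trC-ren h (cpair t u) = cong₂ (case sv) (trC-ren h t) (trC-ren h u)
    trC-ren h (clam t) = cong (lettens sv) (trC-ren (ext-tr h) t)
    trC-ren h (cfst t) = ren-post h t (inl sv) refl
    trC-ren h (csnd t) = ren-post h t (inr sv) refl
    trC-ren h (capp s t) = ren-post h s (tens (trV t) sv) (cong (λ b → tens b sv) (trV-ren h t))
    trC-ren h (lettop t u) = ren-post h t (lapp (trV u) sv) (cong (λ b → lapp b sv) (trV-ren h u))
    trC-ren h (letbang t u) =
      ren-post h t (clam (lapp (trV u) sv)) (cong (λ b → clam (lapp b sv)) (trV-ren (ext-tr h) u))
    trC-ren h (tens t u) = ren-post h u (capp sv (trV t)) (cong (capp sv) (trV-ren h t))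
    trC-ren h (lettens s t) = ren-post h s (clam (trC t)) (cong clam (trC-ren (ext-tr h) t))
    trC-ren h (abort t) = ren-post h t cunit refl
    trC-ren h (inl t) = ren-post h t (cfst sv) refl
    trC-ren h (inr t) = ren-post h t (csnd sv) refl
    trC-ren h (case s t u) =
      ren-post h s (cpair (trC t) (trC u)) (cong₂ cpair (trC-ren h t) (trC-ren h u))
    trC-ren h (lapp s t) = ren-post h t (lapp (trV s) sv) (cong (λ b → lapp b sv) (trV-ren h s))

    ren-post : {ρ : Ren Γ Γ'} {ρ' : Ren (ctx Γ) (ctx Γ')}
             → (h : ∀ {A} (x : Γ ∋ A) → ρ' (trVar x) ≡ trVar (ρ x))
             → (a : Tm Γ (just D) (U X)) (K : Tm (ctx Γ) (just Y) (U (ct X)))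
             → {K' : Tm (ctx Γ') (just Y) (U (ct X))} → K' ≡ ren ρ' K
             → ssub (trC (ren ρ a)) K' ≡ ren ρ' (ssub (trC a) K)
    ren-post {ρ' = ρ'} h a K eq =
      trans (cong₂ ssub (trC-ren h a) eq) (sym (ren-ssub ρ' (trC a) K))

  mutual
    trC-ssub : (t : Tm Γ (just X) (U Y)) (s : Tm Γ (just D) (U X))
             → trC (ssub t s) ≋ ssub (trC s) (trC t)
    trC-ssub sv            s = ≡→≋ (sym (ssub-sv (trC s)))
    trC-ssub cunit         s = ≋-sym (ssub-abort (trC s) sv)
    trC-ssub (cpair a b)   s =
      ≋-trans (≋-case ≋-refl (trC-ssub a s) (trC-ssub b s))
              (≋-sym (ssub-case (trC s) sv (trC a) (trC b)))
    trC-ssub (clam a)      s =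
      ≋-trans (≋-lettens ≋-refl (≋-trans (trC-ssub a (wk s))
                                         (≡→≋ (cong (λ z → ssub z (trC a)) (trC-ren (λ _ → refl) s)))))
              (≋-sym (ssub-lettens (trC s) sv (trC a)))
    trC-ssub (cfst a)      s = trC-ssub-then a s (inl sv)
    trC-ssub (csnd a)      s = trC-ssub-then a s (inr sv)
    trC-ssub (capp a b)    s = trC-ssub-then a s (tens (trV b) sv)
    trC-ssub (lettop a b)  s = trC-ssub-then a s (lapp (trV b) sv)
    trC-ssub (letbang a b) s = trC-ssub-then a s (clam (lapp (trV b) sv))
    trC-ssub (tens a b)    s = trC-ssub-then b s (capp sv (trV a))
    trC-ssub (lettens a b) s = trC-ssub-then a s (clam (trC b))
    trC-ssub (abort a)     s = trC-ssub-then a s cunit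
    trC-ssub (inl a)       s = trC-ssub-then a s (cfst sv)
    trC-ssub (inr a)       s = trC-ssub-then a s (csnd sv)
    trC-ssub (case a b c)  s = trC-ssub-then a s (cpair (trC b) (trC c))
    trC-ssub (lapp a b)    s = trC-ssub-then b s (lapp (trV a) sv)

    trC-ssub-then : {W : CTy} (a : Tm Γ (just X) (U W)) (s : Tm Γ (just D) (U X))
                    (K : Tm (ctx Γ) (just Y) (U (ct W)))
                  → ssub (trC (ssub a s)) K ≋ ssub (trC s) (ssub (trC a) K)
    trC-ssub-then a s K = ≋-trans (≋-ssub₁ (trC-ssub a s) K) (≡→≋ (ssub-assoc (trC s) (trC a) K))

sub-ren-cl : {Γ₁ Γ₂ Γ₃ : Ctx} (σ : Sub Γ₂ Γ₃) (ρ : Ren Γ₁ Γ₂) (t : Tm [] Δ TT)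
           → sub σ (ren ρ (cl t)) ≡ cl t
sub-ren-cl σ ρ t = trans (cong (sub σ) (ren-cl ρ t)) (sub-cl σ t)

β-→-≡ : (body : Tm (A ∷ Γ) nothing B) (p : Tm Γ nothing A) {rhs : Tm Γ nothing B}
      → body [ p ] ≡ rhs → app (lam body) p ≋ rhs
β-→-≡ body p eq = ≋-trans (β-→ body p) (≡→≋ eq)

β-⊸-≡ : (body : Tm Γ (just X) (U Y)) (a : Tm Γ Δ (U X)) {rhs : Tm Γ Δ (U Y)}
      → ssub body a ≡ rhs → lapp (llam body) a ≋ rhs
β-⊸-≡ body a eq = ≋-trans (β-⊸ body a) (≡→≋ eq)

from-[] : Ren [] Γ
from-[] ()

cancel-→ : (f : Tm [] nothing (B t→ A)) (g : Tm [] nothing (A t→ B))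
         → lam (app (cl f) (app (cl g) (var here))) ≋ lam (var here)
         → (a : Tm Γ nothing A) → app (cl f) (app (cl g) a) ≋ a
cancel-→ f g fg a = begin
  app (cl f) (app (cl g) a)   ≡⟨ cong₂ (λ f' g' → app f' (app g' a)) (sub-ren-cl _ _ f) (sub-ren-cl _ _ g) ⟨
  body [ a ]                  ≈⟨ β-→ body a ⟨
  app (lam body) a            ≈⟨ ≋-app (≋-ren from-[] fg) ≋-refl ⟩
  app (lam (var here)) a      ≈⟨ β-→ (var here) a ⟩
  a                           ∎
  where
  open ≋-Reasoning
  body = app (ren (ext from-[]) (cl f)) (app (ren (ext from-[]) (cl g)) (var here))

cancel-⊸ : (f : Tm [] nothing (Y ⊸ X)) (g : Tm [] nothing (X ⊸ Y))
         → llam (lapp (cl f) (lapp (cl g) sv)) ≋ llam sv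
         → (a : Tm Γ Δ (U X)) → lapp (cl f) (lapp (cl g) a) ≋ a
cancel-⊸ f g fg a = begin
  lapp (cl f) (lapp (cl g) a)   ≡⟨ cong₂ (λ f' g' → lapp f' (lapp g' a)) (ren-cl _ f) (ren-cl _ g) ⟨
  ssub body a                   ≈⟨ β-⊸ body a ⟨
  lapp (llam body) a            ≈⟨ ≋-lapp (≋-ren from-[] fg) ≋-refl ⟩
  lapp (llam sv) a              ≈⟨ β-⊸ sv a ⟩
  a                             ∎
  where
  open ≋-Reasoning
  body = lapp (ren from-[] (cl f)) (lapp (ren from-[] (cl g)) sv)

-- R̲° = I̲ holds only propositionally, so ⊤ at type R̲° and the cast from R̲° to I̲ are transports
-- along that equation; these lemmas are proved once for an arbitrary equation W ≡ I̲.
module _ {W : CTy} where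
  castI : W ≡ cI → Tm Γ Δ (U W) → Tm Γ Δ (U cI)
  castI {Γ = Γ} {Δ = Δ} e = subst (λ V → Tm Γ Δ (U V)) e

  topW : W ≡ cI → Tm Γ nothing (U W)
  topW {Γ = Γ} e = subst (λ V → Tm Γ nothing (U V)) (sym e) top

  castI-top : (e : W ≡ cI) → castI e (topW {Γ = Γ} e) ≡ top
  castI-top refl = refl

  castI-ssub : (e : W ≡ cI) (s : Tm Γ Δ (U W)) → ssub (castI e sv) s ≡ castI e s
  castI-ssub refl s = refl

  castI-sub : (e : W ≡ cI) (σ : Sub Γ Γ') (x : Tm Γ Δ (U W)) → sub σ (castI e x) ≡ castI e (sub σ x)
  castI-sub refl σ x = refl

  topW-sub : (e : W ≡ cI) (σ : Sub Γ Γ') → sub σ (topW e) ≡ topW e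
  topW-sub refl σ = refl

  topW-ren : (e : W ≡ cI) (ρ : Ren Γ Γ') → ren ρ (topW e) ≡ topW e
  topW-ren refl ρ = refl

  η-I-cast : (e : W ≡ cI) (a : Tm Γ Δ (U W)) (G : Tm Γ nothing (W ⊸ Z))
           → lettop (castI e a) (lapp G (topW e)) ≋ lapp G a
  η-I-cast refl a G = η-I (lapp G sv) a

module Main (R : CTy) (R°≡I : Translation.ct R R ≡ cI)
  (invV : (A : VTy) → Tm [] nothing (A t→ Translation.vt R (Translation.vt R A)))
  (invC : (X : CTy) → Tm [] nothing (X ⊸ Translation.ct R (Translation.ct R X)))
  (inv : Theta.AreInverses R R°≡I invV invC) where
  open Translation R
  open Theta R R°≡I invV invC
  open TranslationLemmas R
  open AreInverses inv
  open ≋-Reasoning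

  Θv : (A : VTy) → Tm Γ nothing (vt (vt A)) → Tm Γ nothing A
  Θv A a = app (cl (θV A)) a

  Θv⁻¹ : (A : VTy) → Tm Γ nothing A → Tm Γ nothing (vt (vt A))
  Θv⁻¹ A a = app (cl (invV A)) a

  Θc : (X : CTy) → Tm Γ Δ (U (ct (ct X))) → Tm Γ Δ (U X)
  Θc X a = lapp (cl (θC X)) a

  Θc⁻¹ : (X : CTy) → Tm Γ Δ (U X) → Tm Γ Δ (U (ct (ct X)))
  Θc⁻¹ X a = lapp (cl (invC X)) a

  Θv-Θv⁻¹ : (a : Tm Γ nothing A) → Θv A (Θv⁻¹ A a) ≋ a
  Θv-Θv⁻¹ {A = A} = cancel-→ (θV A) (invV A) (θ∘inv A)

  Θv⁻¹-Θv : (a : Tm Γ nothing (vt (vt A))) → Θv⁻¹ A (Θv A a) ≋ a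
  Θv⁻¹-Θv {A = A} = cancel-→ (invV A) (θV A) (inv∘θ A)

  Θc-Θc⁻¹ : (a : Tm Γ Δ (U X)) → Θc X (Θc⁻¹ X a) ≋ a
  Θc-Θc⁻¹ {X = X} = cancel-⊸ (θC X) (invC X) (θ∘invC X)

  Θc⁻¹-Θc : (a : Tm Γ Δ (U (ct (ct X)))) → Θc⁻¹ X (Θc X a) ≋ a
  Θc⁻¹-Θc {X = X} = cancel-⊸ (invC X) (θC X) (invC∘θ X)

  topR : Tm Γ nothing (U (ct R))
  topR = topW R°≡I

  toI : Tm Γ Δ (U (ct R)) → Tm Γ Δ (U cI)
  toI = castI R°≡I

  -- One-step unfolding of θ and θ̲ at each type former.  Where the definition of θ transports
  -- along R̲° = I̲, the unfolding is proved for an arbitrary equation and then instantiated.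
  Θv-× : (p : Tm Γ nothing (vt (vt A) t× vt (vt B)))
       → Θv (A t× B) p ≋ pair (Θv A (fst p)) (Θv B (snd p))
  Θv-× {A = A} {B = B} p =
    β-→-≡ _ p (cong₂ (λ f g → pair (app f (fst p)) (app g (snd p)))
                     (sub-ren-cl _ _ (θV A)) (sub-ren-cl _ _ (θV B)))

  Θv-→ : (f : Tm Γ nothing (vt (vt A) t→ vt (vt B)))
       → Θv (A t→ B) f ≋ lam (Θv B (app (wk f) (Θv⁻¹ A (var here))))
  Θv-→ {A = A} {B = B} f =
    β-→-≡ _ f (cong lam (cong₂ (λ g h → app g (app (wk f) (app h (var here))))
                               (sub-ren-cl _ _ (θV B)) (sub-ren-cl _ _ (invV A))))

  Θv-U : (f : Tm Γ nothing (ct R ⊸ ct (ct X))) → Θv (U X) f ≋ Θc X (lapp f topR)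
  Θv-U = along R°≡I
    where
    along : ∀ {W} (e : W ≡ cI) (f : Tm Γ nothing (W ⊸ ct (ct X)))
          → app (cl (subst (λ V → Tm [] nothing ((V ⊸ ct (ct X)) t→ U X)) (sym e)
                           (lam (lapp (cl (θC X)) (lapp (var here) top))))) f
            ≋ Θc X (lapp f (topW e))
    along {X = X} refl f = β-→-≡ _ f (cong (λ g → lapp g (lapp f top)) (sub-ren-cl _ _ (θC X)))

  Θv-⊸ : (f : Tm Γ nothing (ct (ct X) ⊸ ct (ct Y)))
       → Θv (X ⊸ Y) f ≋ llam (Θc Y (lapp f (Θc⁻¹ X sv)))
  Θv-⊸ {X = X} {Y = Y} f =
    β-→-≡ _ f (cong llam (cong₂ (λ g h → lapp g (lapp f (lapp h sv)))
                                (sub-ren-cl _ _ (θC Y)) (sub-ren-cl _ _ (invC X))))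

  Θc-& : (a : Tm Γ Δ (U (ct (ct X) & ct (ct Y))))
       → Θc (X & Y) a ≋ cpair (Θc X (cfst a)) (Θc Y (csnd a))
  Θc-& {X = X} {Y = Y} a =
    β-⊸-≡ _ a (cong₂ (λ f g → cpair (lapp f (cfst a)) (lapp g (csnd a)))
                     (ren-cl _ (θC X)) (ren-cl _ (θC Y)))

  Θc-⇒ : (b : Tm Γ Δ (U (vt (vt A) ⇒ ct (ct Y))))
       → Θc (A ⇒ Y) b ≋ clam (Θc Y (capp (wk b) (Θv⁻¹ A (var here))))
  Θc-⇒ {A = A} {Y = Y} b =
    β-⊸-≡ _ b (cong clam (cong₂ (λ f g → lapp f (capp (wk b) (app g (var here))))
                                (ren-cl _ (θC Y)) (ren-cl _ (invV A))))

  Θc-I : (a : Tm Γ Δ (U (ct R))) → Θc cI a ≋ toI a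
  Θc-I = along R°≡I
    where
    along : ∀ {W} (e : W ≡ cI) (a : Tm Γ Δ (U W))
          → lapp (cl (subst (λ V → Tm [] nothing (V ⊸ cI)) (sym e) (llam sv))) a ≋ castI e a
    along refl a = β-⊸-≡ _ a refl

  Θc-! : (a : Tm Γ Δ (U (vt (vt A) !⊗ ct R)))
       → Θc (! A) a ≋ lettens a (lettop (toI sv) (bang (Θv A (var here))))
  Θc-! = along R°≡I
    where
    along : ∀ {W} (e : W ≡ cI) (a : Tm Γ Δ (U (vt (vt A) !⊗ W)))
          → lapp (cl (subst (λ V → Tm [] nothing ((vt (vt A) !⊗ V) ⊸ ! A)) (sym e)
                            (llam (lettens sv (lettop sv (bang (app (cl (θV A)) (var here)))))))) a
            ≋ lettens a (lettop (castI e sv) (bang (Θv A (var here))))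
    along {A = A} refl a =
      β-⊸-≡ _ a (cong (λ f → lettens a (lettop sv (bang (app f (var here))))) (ren-cl _ (θV A)))

  Θc-⊗ : (b : Tm Γ Δ (U (vt (vt A) !⊗ ct (ct Y))))
       → Θc (A !⊗ Y) b ≋ lettens b (tens (Θv A (var here)) (Θc Y sv))
  Θc-⊗ {A = A} {Y = Y} b =
    β-⊸-≡ _ b (cong₂ (λ f g → lettens b (tens (app f (var here)) (lapp g sv)))
                     (ren-cl _ (θV A)) (ren-cl _ (θC Y)))

  Θc-0 : (b : Tm Γ Δ (U c0)) → Θc c0 b ≋ b
  Θc-0 b = β-⊸-≡ _ b refl

  Θc-⊕ : (b : Tm Γ Δ (U (ct (ct X) ⊕ ct (ct Y))))
       → Θc (X ⊕ Y) b ≋ case b (inl (Θc X sv)) (inr (Θc Y sv))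
  Θc-⊕ {X = X} {Y = Y} b =
    β-⊸-≡ _ b (cong₂ (λ f g → case b (inl (lapp f sv)) (inr (lapp g sv)))
                     (ren-cl _ (θC X)) (ren-cl _ (θC Y)))

  -- the stoup type, with an empty stoup read as I̲
  stoupTy : Stoup → CTy
  stoupTy nothing  = cI
  stoupTy (just X) = X

  -- the double translation as a stoup-linear term: t°° for a stoup term, t•• applied to the
  -- stoup variable for a term with empty stoup
  tr² : Tm Γ Δ (U Y) → Tm (ctx (ctx Γ)) (just (ct (ct (stoupTy Δ)))) (U (ct (ct Y)))
  tr² {Δ = nothing} t = lapp (trV (trV t)) sv
  tr² {Δ = just X}  t = trC (trC t)

  -- what is substituted for the stoup variable of tr² t: θ̲⁻¹{z}, or ⊤ for an empty stoup
  θ⁻¹-stoup : (Δ : Stoup) → Tm Γ Δ (U (ct (ct (stoupTy Δ))))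
  θ⁻¹-stoup nothing  = topR
  θ⁻¹-stoup (just X) = Θc⁻¹ X sv

  tr²θ : Tm Γ Δ (U Y) → Tm Γ Δ (U (ct (ct Y)))
  tr²θ {Γ = Γ} {Δ = Δ} t = ssub (sub (θsub Γ) (tr² t)) (θ⁻¹-stoup Δ)

  θ⁻¹-stoup-sub : (Δ : Stoup) (σ : Sub Γ Γ') → sub σ (θ⁻¹-stoup Δ) ≡ θ⁻¹-stoup Δ
  θ⁻¹-stoup-sub nothing  σ = topW-sub R°≡I σ
  θ⁻¹-stoup-sub (just X) σ = cong (λ f → lapp f sv) (sub-cl σ (invC X))

  θ⁻¹-stoup-ren : (Δ : Stoup) (ρ : Ren Γ Γ') → ren ρ (θ⁻¹-stoup Δ) ≡ θ⁻¹-stoup Δ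
  θ⁻¹-stoup-ren nothing  ρ = topW-ren R°≡I ρ
  θ⁻¹-stoup-ren (just X) ρ = cong (λ f → lapp f sv) (ren-cl ρ (invC X))

  -- The double translation is compositional up to provable equality: each clause is β for ⊸
  -- (empty stoup) or the reversal of stoup substitution applied twice (nonempty stoup).
  tr²-cpair : (t : Tm Γ Δ (U X)) (u : Tm Γ Δ (U Y)) → tr² (cpair t u) ≋ cpair (tr² t) (tr² u)
  tr²-cpair {Δ = nothing} t u = β-⊸-sv _
  tr²-cpair {Δ = just _}  t u = ≋-refl

  tr²-cfst : (t : Tm Γ Δ (U (X & Y))) → tr² (cfst t) ≋ cfst (tr² t)
  tr²-cfst {Δ = nothing} t = β-⊸-sv _
  tr²-cfst {Δ = just _}  t = trC-ssub (trC t) (inl sv)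

  tr²-csnd : (t : Tm Γ Δ (U (X & Y))) → tr² (csnd t) ≋ csnd (tr² t)
  tr²-csnd {Δ = nothing} t = β-⊸-sv _
  tr²-csnd {Δ = just _}  t = trC-ssub (trC t) (inr sv)

  tr²-clam : (t : Tm (A ∷ Γ) Δ (U Y)) → tr² (clam t) ≋ clam (tr² t)
  tr²-clam {Δ = nothing} t = β-⊸-sv _
  tr²-clam {Δ = just _}  t = ≋-refl

  tr²-capp : (s : Tm Γ Δ (U (A ⇒ Y))) (t : Tm Γ nothing A)
           → tr² (capp s t) ≋ capp (tr² s) (trV (trV t))
  tr²-capp {Δ = nothing} s t = β-⊸-sv _
  tr²-capp {Δ = just _}  s t = trC-ssub (trC s) (tens (trV t) sv)

  tr²-top : tr² {Γ = Γ} top ≋ sv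
  tr²-top = β-⊸-sv _

  tr²-lettop : (t : Tm Γ Δ (U cI)) (u : Tm Γ nothing (U X))
             → tr² (lettop t u) ≋ lapp (trV (trV u)) (tr² t)
  tr²-lettop {Δ = nothing} t u = β-⊸-sv _
  tr²-lettop {Δ = just _}  t u = trC-ssub (trC t) (lapp (trV u) sv)

  tr²-bang : (t : Tm Γ nothing A) → tr² (bang t) ≋ tens (trV (trV t)) sv
  tr²-bang t = β-⊸-sv _

  tr²-letbang : (t : Tm Γ Δ (U (! A))) (u : Tm (A ∷ Γ) nothing (U Y))
              → tr² (letbang t u) ≋ lettens (tr² t) (lapp (trV (trV u)) sv)
  tr²-letbang {Δ = nothing} t u = β-⊸-sv _
  tr²-letbang {Δ = just _}  t u = trC-ssub (trC t) (clam (lapp (trV u) sv))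

  tr²-tens : (t : Tm Γ nothing A) (u : Tm Γ Δ (U Y)) → tr² (tens t u) ≋ tens (trV (trV t)) (tr² u)
  tr²-tens {Δ = nothing} t u = β-⊸-sv _
  tr²-tens {Δ = just _}  t u = trC-ssub (trC u) (capp sv (trV t))

  tr²-lettens : (s : Tm Γ Δ (U (A !⊗ Y))) (t : Tm (A ∷ Γ) (just Y) (U Z))
              → tr² (lettens s t) ≋ lettens (tr² s) (tr² t)
  tr²-lettens {Δ = nothing} s t = β-⊸-sv _
  tr²-lettens {Δ = just _}  s t = trC-ssub (trC s) (clam (trC t))

  tr²-abort : (t : Tm Γ Δ (U c0)) → tr² (abort {X = X} t) ≋ abort (tr² t)
  tr²-abort {Δ = nothing} t = β-⊸-sv _
  tr²-abort {Δ = just _}  t = trC-ssub (trC t) cunit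

  tr²-inl : (t : Tm Γ Δ (U X)) → tr² (inl {Y = Y} t) ≋ inl (tr² t)
  tr²-inl {Δ = nothing} t = β-⊸-sv _
  tr²-inl {Δ = just _}  t = trC-ssub (trC t) (cfst sv)

  tr²-inr : (t : Tm Γ Δ (U Y)) → tr² (inr {X = X} t) ≋ inr (tr² t)
  tr²-inr {Δ = nothing} t = β-⊸-sv _
  tr²-inr {Δ = just _}  t = trC-ssub (trC t) (csnd sv)

  tr²-case : (s : Tm Γ Δ (U (X ⊕ Y))) (t : Tm Γ (just X) (U Z)) (u : Tm Γ (just Y) (U Z))
           → tr² (case s t u) ≋ case (tr² s) (tr² t) (tr² u)
  tr²-case {Δ = nothing} s t u = β-⊸-sv _
  tr²-case {Δ = just _}  s t u = trC-ssub (trC s) (cpair (trC t) (trC u))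

  tr²-lapp : (s : Tm Γ nothing (X ⊸ Y)) (t : Tm Γ Δ (U X))
           → tr² (lapp s t) ≋ lapp (trV (trV s)) (tr² t)
  tr²-lapp {Δ = nothing} s t = β-⊸-sv _
  tr²-lapp {Δ = just _}  s t = trC-ssub (trC t) (lapp (trV s) sv)

  ValueThm : Tm Γ nothing A → Set
  ValueThm {Γ = Γ} {A = A} t = t ≋ sub (θsub Γ) (Θv A (trV (trV t)))

  CompThm : Tm Γ Δ (U Y) → Set
  CompThm {Y = Y} t = t ≋ Θc Y (tr²θ t)

  -- θ is closed, so substitution passes under it
  sub-Θv : (σ : Sub Γ Γ') (a : Tm Γ nothing (vt (vt A))) → sub σ (Θv A a) ≡ Θv A (sub σ a)
  sub-Θv {A = A} σ a = cong (λ f → app f (sub σ a)) (sub-cl σ (θV A))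

  value-inside : {t : Tm Γ nothing A} → ValueThm t → t ≋ Θv A (sub (θsub Γ) (trV (trV t)))
  value-inside {Γ = Γ} {t = t} p = ≋-trans p (≡→≋ (sub-Θv (θsub Γ) (trV (trV t))))

  Θv-U-tr² : (t : Tm Γ nothing (U Y)) → sub (θsub Γ) (Θv (U Y) (trV (trV t))) ≋ Θc Y (tr²θ t)
  Θv-U-tr² {Γ = Γ} t =
    ≋-trans (≡→≋ (sub-Θv (θsub Γ) (trV (trV t)))) (Θv-U (sub (θsub Γ) (trV (trV t))))

  comp-via : (t : Tm Γ Δ (U Y)) {r : Tm (ctx (ctx Γ)) (just (ct (ct (stoupTy Δ)))) (U (ct (ct Y)))}
           → tr² t ≋ r → {x : Tm Γ Δ (U Y)}
           → x ≋ Θc Y (ssub (sub (θsub Γ) r) (θ⁻¹-stoup Δ)) → x ≋ Θc Y (tr²θ t)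
  comp-via {Γ = Γ} {Δ = Δ} t tr²t≋r x≋ =
    ≋-trans x≋ (≋-lapp ≋-refl (≋-sym (≋-ssub₁ (≋-sub (θsub Γ) tr²t≋r) (θ⁻¹-stoup Δ))))

  θsub-var : (x : Γ ∋ A) → θsub Γ (trVar (trVar x)) ≡ Θv⁻¹ A (var x)
  θsub-var here = refl
  θsub-var {A = A} (there x) =
    trans (cong wk (θsub-var x)) (cong (λ f → app f (var (there x))) (ren-cl there (invV A)))

  θsub-exts : (r : Tm (vt (vt A) ∷ ctx (ctx Γ)) Δ TT)
            → (ren (ext there) (sub (exts (θsub Γ)) r)) [ Θv⁻¹ A (var here) ] ≡ sub (θsub (A ∷ Γ)) r
  θsub-exts {A = A} {Γ = Γ} r =
    trans (sub-ren {σ' = τ} (λ { here → refl ; (there y) → refl }) (sub (exts (θsub Γ)) r))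
          (sub-sub h r)
    where
    τ : Sub (vt (vt A) ∷ Γ) (A ∷ Γ)
    τ here      = Θv⁻¹ A (var here)
    τ (there y) = var (there y)
    h : ∀ {C} (x : (vt (vt A) ∷ ctx (ctx Γ)) ∋ C) → sub τ (exts (θsub Γ) x) ≡ θsub (A ∷ Γ) x
    h here      = refl
    h (there x) = trans (sub-ren (λ _ → refl) (θsub Γ x)) (sym (ren-as-sub (λ _ → refl) (θsub Γ x)))

  -- The value cases: each is the induction hypothesis followed by the unfolding of θ at
  -- the type of the term and a β-step.
  value-var : (x : Γ ∋ A) → ValueThm (var x)
  value-var {Γ = Γ} {A = A} x = begin
    var x                                          ≈⟨ Θv-Θv⁻¹ (var x) ⟨
    Θv A (Θv⁻¹ A (var x))                          ≡⟨ cong (Θv A) (θsub-var x) ⟨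
    Θv A (θsub Γ (trVar (trVar x)))                ≡⟨ sub-Θv (θsub Γ) (var (trVar (trVar x))) ⟨
    sub (θsub Γ) (Θv A (var (trVar (trVar x))))    ∎

  value-unit : ValueThm {Γ = Γ} unit
  value-unit = ≋-sym (η-1 _)

  value-pair : (t : Tm Γ nothing A) (u : Tm Γ nothing B) → ValueThm t → ValueThm u
             → ValueThm (pair t u)
  value-pair {Γ = Γ} {A = A} {B = B} t u ih-t ih-u = begin
    pair t u                                       ≈⟨ ≋-pair (value-inside ih-t) (value-inside ih-u) ⟩
    pair (Θv A a) (Θv B b)                         ≈⟨ ≋-pair (≋-app ≋-refl (β-×₁ a b))
                                                            (≋-app ≋-refl (β-×₂ a b)) ⟨
    pair (Θv A (fst (pair a b))) (Θv B (snd (pair a b)))  ≈⟨ Θv-× (pair a b) ⟨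
    Θv (A t× B) (pair a b)                         ≡⟨ sub-Θv (θsub Γ) (pair (trV (trV t)) (trV (trV u))) ⟨
    sub (θsub Γ) (Θv (A t× B) (trV (trV (pair t u))))  ∎
    where
    a = sub (θsub Γ) (trV (trV t))
    b = sub (θsub Γ) (trV (trV u))

  value-fst : (t : Tm Γ nothing (A t× B)) → ValueThm t → ValueThm (fst t)
  value-fst {Γ = Γ} {A = A} {B = B} t ih = begin
    fst t                                          ≈⟨ ≋-fst (value-inside ih) ⟩
    fst (Θv (A t× B) p)                            ≈⟨ ≋-fst (Θv-× p) ⟩
    fst (pair (Θv A (fst p)) (Θv B (snd p)))       ≈⟨ β-×₁ _ _ ⟩
    Θv A (fst p)                                   ≡⟨ sub-Θv (θsub Γ) (fst (trV (trV t))) ⟨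
    sub (θsub Γ) (Θv A (trV (trV (fst t))))        ∎
    where p = sub (θsub Γ) (trV (trV t))

  value-snd : (t : Tm Γ nothing (A t× B)) → ValueThm t → ValueThm (snd t)
  value-snd {Γ = Γ} {A = A} {B = B} t ih = begin
    snd t                                          ≈⟨ ≋-snd (value-inside ih) ⟩
    snd (Θv (A t× B) p)                            ≈⟨ ≋-snd (Θv-× p) ⟩
    snd (pair (Θv A (fst p)) (Θv B (snd p)))       ≈⟨ β-×₂ _ _ ⟩
    Θv B (snd p)                                   ≡⟨ sub-Θv (θsub Γ) (snd (trV (trV t))) ⟨
    sub (θsub Γ) (Θv B (trV (trV (snd t))))        ∎
    where p = sub (θsub Γ) (trV (trV t))

  value-lam : (t : Tm (A ∷ Γ) nothing B) → ValueThm t → ValueThm (lam t)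
  value-lam {A = A} {Γ = Γ} {B = B} t ih = begin
    lam t                                                  ≈⟨ ≋-lam (value-inside ih) ⟩
    lam (Θv B (sub (θsub (A ∷ Γ)) T))                      ≡⟨ cong (λ z → lam (Θv B z)) (θsub-exts T) ⟨
    lam (Θv B ((ren (ext there) T') [ Θv⁻¹ A (var here) ])) ≈⟨ ≋-lam (≋-app ≋-refl (β-→ _ _)) ⟨
    lam (Θv B (app (wk (lam T')) (Θv⁻¹ A (var here))))     ≈⟨ Θv-→ (lam T') ⟨
    Θv (A t→ B) (lam T')                                   ≡⟨ sub-Θv (θsub Γ) (lam T) ⟨
    sub (θsub Γ) (Θv (A t→ B) (lam T))                     ∎
    where
    T  = trV (trV t)
    T' = sub (exts (θsub Γ)) T

  value-app : (t : Tm Γ nothing (A t→ B)) (u : Tm Γ nothing A) → ValueThm t → ValueThm u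
            → ValueThm (app t u)
  value-app {Γ = Γ} {A = A} {B = B} t u ih-t ih-u = begin
    app t u                                        ≈⟨ ≋-app (≋-trans (value-inside ih-t) (Θv-→ F)) ≋-refl ⟩
    app (lam (Θv B (app (wk F) (Θv⁻¹ A (var here))))) u  ≈⟨ β-→-≡ _ u eq ⟩
    Θv B (app F (Θv⁻¹ A u))                        ≈⟨ in-F (≋-app ≋-refl (value-inside ih-u)) ⟩
    Θv B (app F (Θv⁻¹ A (Θv A a)))                 ≈⟨ in-F (Θv⁻¹-Θv a) ⟩
    Θv B (app F a)                                 ≡⟨ sub-Θv (θsub Γ) (trV (trV (app t u))) ⟨
    sub (θsub Γ) (Θv B (trV (trV (app t u))))      ∎
    where
    F = sub (θsub Γ) (trV (trV t))
    a = sub (θsub Γ) (trV (trV u))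
    in-F : {x y : Tm Γ nothing (vt (vt A))} → x ≋ y → Θv B (app F x) ≋ Θv B (app F y)
    in-F p = ≋-app ≋-refl (≋-app ≋-refl p)
    eq : (Θv B (app (wk F) (Θv⁻¹ A (var here)))) [ u ] ≡ Θv B (app F (Θv⁻¹ A u))
    eq = cong₃ (λ f g h → app f (app g (app h u))) (sub-cl _ (θV B)) (wk-single F u) (sub-cl _ (invV A))

  value-llam : (t : Tm Γ (just X) (U Y)) → CompThm t → ValueThm (llam t)
  value-llam {Γ = Γ} {X = X} {Y = Y} t ih = begin
    llam t                                         ≈⟨ ≋-llam ih ⟩
    llam (Θc Y (ssub S (Θc⁻¹ X sv)))               ≈⟨ ≋-llam (≋-lapp ≋-refl (β-⊸ S _)) ⟨
    llam (Θc Y (lapp (llam S) (Θc⁻¹ X sv)))        ≈⟨ Θv-⊸ (llam S) ⟨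
    Θv (X ⊸ Y) (llam S)                            ≡⟨ sub-Θv (θsub Γ) (llam (trC (trC t))) ⟨
    sub (θsub Γ) (Θv (X ⊸ Y) (trV (trV (llam t)))) ∎
    where S = sub (θsub Γ) (trC (trC t))

  θ-head : Sub (A ∷ Γ) (vt (vt A) ∷ Γ)
  θ-head {A = A} here      = Θv A (var here)
  θ-head         (there x) = var (there x)

  θ-head-single : (u : Tm (A ∷ Γ) Δ TT) → (ren (ext there) u) [ Θv A (var here) ] ≡ sub θ-head u
  θ-head-single u = sub-ren (λ { here → refl ; (there x) → refl }) u

  -- θ-head after θ⁻¹(A ∷ Γ) is θ⁻¹(Γ) lifted under the binder, since θ⁻¹(θ x') = x'
  θ-head-θsub : (r : Tm (ctx (ctx (A ∷ Γ))) Δ TT)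
              → sub θ-head (sub (θsub (A ∷ Γ)) r) ≋ sub (exts (θsub Γ)) r
  θ-head-θsub {A = A} {Γ = Γ} r =
    ≋-trans (≡→≋ (sub-sub {σ₃ = λ x → sub θ-head (θsub (A ∷ Γ) x)} (λ _ → refl) r)) (sub-≋ h r)
    where
    h : ∀ {C} (x : ctx (ctx (A ∷ Γ)) ∋ C) → sub θ-head (θsub (A ∷ Γ) x) ≋ exts (θsub Γ) x
    h here      = ≋-trans (≡→≋ (cong (λ f → app f (Θv A (var here))) (sub-cl θ-head (invV A))))
                          (Θv⁻¹-Θv (var here))
    h (there x) = ≡→≋ (trans (sub-ren (λ _ → refl) (θsub Γ x))
                             (sym (ren-as-sub (λ _ → refl) (θsub Γ x))))

  value-under-θ : (u : Tm (A ∷ Γ) nothing B) → ValueThm u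
                → (ren (ext there) u) [ Θv A (var here) ] ≋ Θv B (sub (exts (θsub Γ)) (trV (trV u)))
  value-under-θ {A = A} {Γ = Γ} {B = B} u ih = begin
    (ren (ext there) u) [ Θv A (var here) ]        ≡⟨ θ-head-single u ⟩
    sub θ-head u                                   ≈⟨ ≋-sub θ-head ih ⟩
    sub θ-head (sub (θsub (A ∷ Γ)) (Θv B (trV (trV u)))) ≈⟨ θ-head-θsub (Θv B (trV (trV u))) ⟩
    sub (exts (θsub Γ)) (Θv B (trV (trV u)))       ≡⟨ sub-Θv (exts (θsub Γ)) (trV (trV u)) ⟩
    Θv B (sub (exts (θsub Γ)) (trV (trV u)))       ∎

  comp-under-θ : (t : Tm (A ∷ Γ) (just Y) (U Z)) → CompThm t
               → (ren (ext there) t) [ Θv A (var here) ]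
                 ≋ Θc Z (ssub (sub (exts (θsub Γ)) (tr² t)) (Θc⁻¹ Y sv))
  comp-under-θ {A = A} {Γ = Γ} {Y = Y} {Z = Z} t ih = begin
    (ren (ext there) t) [ Θv A (var here) ]        ≡⟨ θ-head-single t ⟩
    sub θ-head t                                   ≈⟨ ≋-sub θ-head ih ⟩
    sub θ-head (Θc Z (tr²θ t))                     ≡⟨ cong₂ lapp (sub-cl θ-head (θC Z)) eq ⟩
    Θc Z (ssub (sub θ-head (sub (θsub (A ∷ Γ)) (tr² t))) (Θc⁻¹ Y sv))
                                                   ≈⟨ ≋-lapp ≋-refl (≋-ssub₁ (θ-head-θsub (tr² t)) _) ⟩
    Θc Z (ssub T (Θc⁻¹ Y sv))                      ∎
    where
    T = sub (exts (θsub Γ)) (tr² t)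
    S = sub (θsub (A ∷ Γ)) (tr² t)
    eq : sub θ-head (ssub S (Θc⁻¹ Y sv)) ≡ ssub (sub θ-head S) (Θc⁻¹ Y sv)
    eq = trans (sub-ssub θ-head S (Θc⁻¹ Y sv)) (cong (ssub (sub θ-head S)) (θ⁻¹-stoup-sub (just Y) θ-head))

  Θc-Θc⁻¹-under : (T : Tm Γ (just (ct (ct X))) (U (ct (ct Z))))
                → ssub (Θc Z (ssub T (Θc⁻¹ X sv))) (Θc X sv) ≋ Θc Z T
  Θc-Θc⁻¹-under {X = X} T =
    ≋-lapp ≋-refl (≋-trans (≡→≋ (ssub-assoc T (Θc⁻¹ X sv) (Θc X sv)))
                           (≋-trans (≋-ssub₂ T (Θc⁻¹-Θc sv)) (≡→≋ (ssub-sv T))))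

  comp-branch : (t : Tm Γ (just X) (U Z)) → CompThm t
              → ssub t (Θc X sv) ≋ Θc Z (sub (θsub Γ) (tr² t))
  comp-branch t ih = ≋-trans (≋-ssub₁ ih _) (Θc-Θc⁻¹-under _)

  lettens-Θc : (a : Tm Γ Δ (U (A !⊗ X))) (b : Tm (A ∷ Γ) (just X) (U (ct (ct Y))))
             → lettens a (Θc Y b) ≋ Θc Y (lettens a b)
  lettens-Θc {Y = Y} a b =
    ≋-sym (≋-trans (ssub-lettens (Θc Y sv) a b)
                   (≡→≋ (cong (λ f → lettens a (lapp f b)) (ren-cl there (θC Y)))))

  comp-sv : CompThm {Γ = Γ} (sv {X = X})
  comp-sv = ≋-sym (Θc-Θc⁻¹ sv)

  comp-cunit : CompThm {Γ = Γ} {Δ = Δ} cunit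
  comp-cunit = ≋-sym (η-1̲ _)

  comp-cpair : (t : Tm Γ Δ (U X)) (u : Tm Γ Δ (U Y)) → CompThm t → CompThm u
             → CompThm (cpair t u)
  comp-cpair {X = X} {Y = Y} t u ih-t ih-u = comp-via (cpair t u) (tr²-cpair t u) (begin
    cpair t u                                      ≈⟨ ≋-cpair ih-t ih-u ⟩
    cpair (Θc X (tr²θ t)) (Θc Y (tr²θ u))          ≈⟨ ≋-cpair (≋-lapp ≋-refl (β-&₁ _ _))
                                                              (≋-lapp ≋-refl (β-&₂ _ _)) ⟨
    cpair (Θc X (cfst p)) (Θc Y (csnd p))          ≈⟨ Θc-& p ⟨
    Θc (X & Y) p                                   ∎)
    where p = cpair (tr²θ t) (tr²θ u)

  comp-cfst : (t : Tm Γ Δ (U (X & Y))) → CompThm t → CompThm (cfst t)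
  comp-cfst {X = X} {Y = Y} t ih = comp-via (cfst t) (tr²-cfst t) (begin
    cfst t                                         ≈⟨ ≋-cfst (≋-trans ih (Θc-& _)) ⟩
    cfst (cpair (Θc X (cfst (tr²θ t))) (Θc Y (csnd (tr²θ t))))  ≈⟨ β-&₁ _ _ ⟩
    Θc X (cfst (tr²θ t))                           ∎)

  comp-csnd : (t : Tm Γ Δ (U (X & Y))) → CompThm t → CompThm (csnd t)
  comp-csnd {X = X} {Y = Y} t ih = comp-via (csnd t) (tr²-csnd t) (begin
    csnd t                                         ≈⟨ ≋-csnd (≋-trans ih (Θc-& _)) ⟩
    csnd (cpair (Θc X (cfst (tr²θ t))) (Θc Y (csnd (tr²θ t))))  ≈⟨ β-&₂ _ _ ⟩
    Θc Y (csnd (tr²θ t))                           ∎)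

  comp-clam : (t : Tm (A ∷ Γ) Δ (U Y)) → CompThm t → CompThm (clam t)
  comp-clam {A = A} {Γ = Γ} {Δ = Δ} {Y = Y} t ih = comp-via (clam t) (tr²-clam t) (begin
    clam t                                         ≈⟨ ≋-clam ih ⟩
    clam (Θc Y (tr²θ t))                           ≡⟨ cong (λ z → clam (Θc Y z)) eq ⟨
    clam (Θc Y ((ren (ext there) b) [ u₀ ]))       ≈⟨ ≋-clam (≋-lapp ≋-refl (β-⇒ _ u₀)) ⟨
    clam (Θc Y (capp (wk (clam b)) u₀))            ≈⟨ Θc-⇒ (clam b) ⟨
    Θc (A ⇒ Y) (clam b)                            ∎)
    where
    u₀ = Θv⁻¹ A (var here)
    S  = sub (exts (θsub Γ)) (tr² t)
    b  = ssub S (wk (θ⁻¹-stoup Δ))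
    stoup-eq : (ren (ext there) (wk (θ⁻¹-stoup Δ))) [ u₀ ] ≡ θ⁻¹-stoup Δ
    stoup-eq = trans (cong (λ z → z [ u₀ ]) (trans (cong (ren (ext there)) (θ⁻¹-stoup-ren Δ there))
                                                   (θ⁻¹-stoup-ren Δ (ext there))))
                     (θ⁻¹-stoup-sub Δ _)
    eq : (ren (ext there) b) [ u₀ ] ≡ tr²θ t
    eq = trans (cong (λ z → z [ u₀ ]) (ren-ssub (ext there) S (wk (θ⁻¹-stoup Δ))))
               (trans (sub-ssub _ (ren (ext there) S) (ren (ext there) (wk (θ⁻¹-stoup Δ))))
                      (cong₂ ssub (θsub-exts (tr² t)) stoup-eq))

  comp-capp : (s : Tm Γ Δ (U (A ⇒ Y))) (t : Tm Γ nothing A) → CompThm s → ValueThm t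
            → CompThm (capp s t)
  comp-capp {Γ = Γ} {A = A} {Y = Y} s t ih-s ih-t = comp-via (capp s t) (tr²-capp s t) (begin
    capp s t                                       ≈⟨ ≋-capp (≋-trans ih-s (Θc-⇒ p)) ≋-refl ⟩
    capp (clam body) t                             ≈⟨ β-⇒ body t ⟩
    body [ t ]                                     ≡⟨ eq ⟩
    Θc Y (capp p (Θv⁻¹ A t))                       ≈⟨ ≋-lapp ≋-refl (≋-capp ≋-refl
                                                        (≋-trans (≋-app ≋-refl (value-inside ih-t))
                                                                 (Θv⁻¹-Θv _))) ⟩
    Θc Y (capp p (sub (θsub Γ) (trV (trV t))))     ∎)
    where
    p    = tr²θ s
    body = Θc Y (capp (wk p) (Θv⁻¹ A (var here)))
    eq : body [ t ] ≡ Θc Y (capp p (Θv⁻¹ A t))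
    eq = cong₃ (λ f q g → lapp f (capp q (app g t))) (sub-cl _ (θC Y)) (wk-single p t) (sub-cl _ (invV A))

  comp-top : CompThm {Γ = Γ} top
  comp-top = comp-via top tr²-top (≋-sym (≋-trans (Θc-I topR) (≡→≋ (castI-top R°≡I))))

  comp-lettop : (t : Tm Γ Δ (U cI)) (u : Tm Γ nothing (U X)) → CompThm t → ValueThm u
              → CompThm (lettop t u)
  comp-lettop {Γ = Γ} {X = X} t u ih-t ih-u = comp-via (lettop t u) (tr²-lettop t u) (begin
    lettop t u                                     ≈⟨ ≋-lettop (≋-trans ih-t (Θc-I _))
                                                               (≋-trans ih-u (Θv-U-tr² u)) ⟩
    lettop (toI (tr²θ t)) (Θc X (lapp G topR))     ≈⟨ ssub-lettop (Θc X sv) (toI (tr²θ t)) (lapp G topR) ⟨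
    Θc X (lettop (toI (tr²θ t)) (lapp G topR))     ≈⟨ ≋-lapp ≋-refl (η-I-cast R°≡I (tr²θ t) G) ⟩
    Θc X (lapp G (tr²θ t))                         ∎)
    where G = sub (θsub Γ) (trV (trV u))

  comp-bang : (t : Tm Γ nothing A) → ValueThm t → CompThm (bang t)
  comp-bang {Γ = Γ} {A = A} t ih = comp-via (bang t) (tr²-bang t) (begin
    bang t                                         ≈⟨ ≋-bang (value-inside ih) ⟩
    bang (Θv A a)                                  ≈⟨ β-I _ ⟨
    lettop top (bang (Θv A a))                     ≡⟨ cong (λ z → lettop z (bang (Θv A a))) toI-topR ⟨
    ssub (lettop (toI sv) (bang (Θv A a))) topR    ≡⟨ cong (λ z → ssub z topR) eq ⟨
    ssub (K [ a ]) topR                            ≈⟨ β-⊗ a topR K ⟨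
    lettens (tens a topR) K                        ≈⟨ Θc-! (tens a topR) ⟨
    Θc (! A) (tens a topR)                         ∎)
    where
    a = sub (θsub Γ) (trV (trV t))
    K = lettop (toI sv) (bang (Θv A (var here)))
    toI-topR : ssub (toI sv) topR ≡ top
    toI-topR = trans (castI-ssub R°≡I topR) (castI-top R°≡I)
    eq : K [ a ] ≡ lettop (toI sv) (bang (Θv A a))
    eq = cong₂ (λ x f → lettop x (bang (app f a))) (castI-sub R°≡I _ sv) (sub-cl _ (θV A))

  comp-letbang : (t : Tm Γ Δ (U (! A))) (u : Tm (A ∷ Γ) nothing (U Y)) → CompThm t → ValueThm u
               → CompThm (letbang t u)
  comp-letbang {Γ = Γ} {A = A} {Y = Y} t u ih-t ih-u = comp-via (letbang t u) (tr²-letbang t u) (begin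
    letbang t u                                    ≈⟨ ≋-letbang (≋-trans ih-t (Θc-! _)) ≋-refl ⟩
    letbang (lettens (tr²θ t) K) u                 ≈⟨ ssub-lettens (letbang sv u) (tr²θ t) K ⟩
    lettens (tr²θ t) (ssub (letbang sv u') K)      ≈⟨ ≋-lettens ≋-refl body ⟩
    lettens (tr²θ t) (Θc Y (lapp G sv))            ≈⟨ lettens-Θc (tr²θ t) (lapp G sv) ⟩
    Θc Y (lettens (tr²θ t) (lapp G sv))            ∎)
    where
    G  = sub (exts (θsub Γ)) (trV (trV u))
    K  = lettop (toI sv) (bang (Θv A (var here)))
    u' = ren (ext there) u
    body : ssub (letbang sv u') K ≋ Θc Y (lapp G sv)
    body = begin
      ssub (letbang sv u') K                       ≈⟨ ssub-lettop (letbang sv u') (toI sv) _ ⟩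
      lettop (toI sv) (letbang (bang (Θv A (var here))) u')
                                                   ≈⟨ ≋-lettop ≋-refl (β-! _ u') ⟩
      lettop (toI sv) (u' [ Θv A (var here) ])     ≈⟨ ≋-lettop ≋-refl (value-under-θ u ih-u) ⟩
      lettop (toI sv) (Θv (U Y) G)                 ≈⟨ ≋-lettop ≋-refl (Θv-U G) ⟩
      lettop (toI sv) (Θc Y (lapp G topR))         ≈⟨ ssub-lettop (Θc Y sv) (toI sv) (lapp G topR) ⟨
      Θc Y (lettop (toI sv) (lapp G topR))         ≈⟨ ≋-lapp ≋-refl (η-I-cast R°≡I sv G) ⟩
      Θc Y (lapp G sv)                             ∎

  comp-tens : (t : Tm Γ nothing A) (u : Tm Γ Δ (U Y)) → ValueThm t → CompThm u → CompThm (tens t u)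
  comp-tens {Γ = Γ} {A = A} {Y = Y} t u ih-t ih-u = comp-via (tens t u) (tr²-tens t u) (begin
    tens t u                                       ≈⟨ ≋-tens (value-inside ih-t) ih-u ⟩
    tens (Θv A a) (Θc Y (tr²θ u))                  ≡⟨ cong (λ z → ssub z (tr²θ u)) eq ⟨
    ssub (K [ a ]) (tr²θ u)                        ≈⟨ β-⊗ a (tr²θ u) K ⟨
    lettens (tens a (tr²θ u)) K                    ≈⟨ Θc-⊗ (tens a (tr²θ u)) ⟨
    Θc (A !⊗ Y) (tens a (tr²θ u))                  ∎)
    where
    a = sub (θsub Γ) (trV (trV t))
    K = tens (Θv A (var here)) (Θc Y sv)
    eq : K [ a ] ≡ tens (Θv A a) (Θc Y sv)
    eq = cong₂ (λ f g → tens (app f a) (lapp g sv)) (sub-cl _ (θV A)) (sub-cl _ (θC Y))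

  comp-lettens : (s : Tm Γ Δ (U (A !⊗ Y))) (t : Tm (A ∷ Γ) (just Y) (U Z)) → CompThm s → CompThm t
               → CompThm (lettens s t)
  comp-lettens {Γ = Γ} {A = A} {Y = Y} {Z = Z} s t ih-s ih-t =
    comp-via (lettens s t) (tr²-lettens s t) (begin
    lettens s t                                    ≈⟨ ≋-lettens (≋-trans ih-s (Θc-⊗ _)) ≋-refl ⟩
    lettens (lettens (tr²θ s) K) t                 ≈⟨ ssub-lettens (lettens sv t) (tr²θ s) K ⟩
    lettens (tr²θ s) (lettens K t')                ≈⟨ ≋-lettens ≋-refl body ⟩
    lettens (tr²θ s) (Θc Z T)                      ≈⟨ lettens-Θc (tr²θ s) T ⟩
    Θc Z (lettens (tr²θ s) T)                      ∎)
    where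
    T  = sub (exts (θsub Γ)) (tr² t)
    K  = tens (Θv A (var here)) (Θc Y sv)
    t' = ren (ext there) t
    body : lettens K t' ≋ Θc Z T
    body = begin
      lettens K t'                                 ≈⟨ β-⊗ (Θv A (var here)) (Θc Y sv) t' ⟩
      ssub (t' [ Θv A (var here) ]) (Θc Y sv)      ≈⟨ ≋-ssub₁ (comp-under-θ t ih-t) (Θc Y sv) ⟩
      ssub (Θc Z (ssub T (Θc⁻¹ Y sv))) (Θc Y sv)   ≈⟨ Θc-Θc⁻¹-under T ⟩
      Θc Z T                                       ∎

  comp-abort : (t : Tm Γ Δ (U c0)) → CompThm t → CompThm (abort {X = X} t)
  comp-abort {X = X} t ih = comp-via (abort t) (tr²-abort t)
    (≋-trans (≋-abort (≋-trans ih (Θc-0 _))) (η-0 (Θc X (abort sv)) (tr²θ t)))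

  comp-inl : (t : Tm Γ Δ (U X)) → CompThm t → CompThm (inl {Y = Y} t)
  comp-inl {X = X} {Y = Y} t ih = comp-via (inl t) (tr²-inl t) (begin
    inl t                                          ≈⟨ ≋-inl ih ⟩
    inl (Θc X (tr²θ t))                            ≈⟨ β-⊕₁ (tr²θ t) (inl (Θc X sv)) (inr (Θc Y sv)) ⟨
    case (inl (tr²θ t)) (inl (Θc X sv)) (inr (Θc Y sv))  ≈⟨ Θc-⊕ (inl (tr²θ t)) ⟨
    Θc (X ⊕ Y) (inl (tr²θ t))                      ∎)

  comp-inr : (t : Tm Γ Δ (U Y)) → CompThm t → CompThm (inr {X = X} t)
  comp-inr {Y = Y} {X = X} t ih = comp-via (inr t) (tr²-inr t) (begin
    inr t                                          ≈⟨ ≋-inr ih ⟩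
    inr (Θc Y (tr²θ t))                            ≈⟨ β-⊕₂ (tr²θ t) (inl (Θc X sv)) (inr (Θc Y sv)) ⟨
    case (inr (tr²θ t)) (inl (Θc X sv)) (inr (Θc Y sv))  ≈⟨ Θc-⊕ (inr (tr²θ t)) ⟨
    Θc (X ⊕ Y) (inr (tr²θ t))                      ∎)

  comp-case : (s : Tm Γ Δ (U (X ⊕ Y))) (t : Tm Γ (just X) (U Z)) (u : Tm Γ (just Y) (U Z))
            → CompThm s → CompThm t → CompThm u → CompThm (case s t u)
  comp-case {Γ = Γ} {X = X} {Y = Y} {Z = Z} s t u ih-s ih-t ih-u =
    comp-via (case s t u) (tr²-case s t u) (begin
    case s t u                                     ≈⟨ ≋-case (≋-trans ih-s (Θc-⊕ _)) ≋-refl ≋-refl ⟩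
    case (case p l r) t u                          ≈⟨ ssub-case (case sv t u) p l r ⟩
    case p (case l t u) (case r t u)               ≈⟨ ≋-case ≋-refl
                                                        (≋-trans (β-⊕₁ (Θc X sv) t u) (comp-branch t ih-t))
                                                        (≋-trans (β-⊕₂ (Θc Y sv) t u) (comp-branch u ih-u)) ⟩
    case p (Θc Z Tt) (Θc Z Tu)                     ≈⟨ ssub-case (Θc Z sv) p Tt Tu ⟨
    Θc Z (case p Tt Tu)                            ∎)
    where
    p  = tr²θ s
    l  = inl (Θc X sv)
    r  = inr (Θc Y sv)
    Tt = sub (θsub Γ) (tr² t)
    Tu = sub (θsub Γ) (tr² u)

  comp-lapp : (s : Tm Γ nothing (X ⊸ Y)) (t : Tm Γ Δ (U X)) → ValueThm s → CompThm t
            → CompThm (lapp s t)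
  comp-lapp {Γ = Γ} {X = X} {Y = Y} s t ih-s ih-t = comp-via (lapp s t) (tr²-lapp s t) (begin
    lapp s t                                       ≈⟨ ≋-lapp (≋-trans (value-inside ih-s) (Θv-⊸ F)) ih-t ⟩
    lapp (llam (Θc Y (lapp F (Θc⁻¹ X sv)))) (Θc X (tr²θ t))  ≈⟨ β-⊸ _ _ ⟩
    Θc Y (lapp F (Θc⁻¹ X (Θc X (tr²θ t))))         ≈⟨ ≋-lapp ≋-refl (≋-lapp ≋-refl (Θc⁻¹-Θc _)) ⟩
    Θc Y (lapp F (tr²θ t))                         ∎)
    where F = sub (θsub Γ) (trV (trV s))

  comp→value : (t : Tm Γ nothing (U Y)) → CompThm t → ValueThm t
  comp→value t ih = ≋-trans ih (≋-sym (Θv-U-tr² t))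

  value→comp : (t : Tm Γ nothing (U Y)) → ValueThm t → CompThm t
  value→comp t ih = ≋-trans ih (Θv-U-tr² t)

  -- Both invariants hold for every term.  Computation-type terms with empty stoup are handled
  -- by whichever induction covers their term former, and transferred by comp→value/value→comp.
  mutual
    valueThm : (t : Tm Γ nothing A) → ValueThm t
    valueThm (var x)      = value-var x
    valueThm unit         = value-unit
    valueThm (pair t u)   = value-pair t u (valueThm t) (valueThm u)
    valueThm (fst t)      = value-fst t (valueThm t)
    valueThm (snd t)      = value-snd t (valueThm t)
    valueThm (lam t)      = value-lam t (valueThm t)
    valueThm (app t u)    = value-app t u (valueThm t) (valueThm u)
    valueThm (llam t)     = value-llam t (compThm t)
    valueThm t@cunit          = comp→value t (compThm t)
    valueThm t@(cpair _ _)    = comp→value t (compThm t)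
    valueThm t@(cfst _)       = comp→value t (compThm t)
    valueThm t@(csnd _)       = comp→value t (compThm t)
    valueThm t@(clam _)       = comp→value t (compThm t)
    valueThm t@(capp _ _)     = comp→value t (compThm t)
    valueThm t@top            = comp→value t (compThm t)
    valueThm t@(lettop _ _)   = comp→value t (compThm t)
    valueThm t@(bang _)       = comp→value t (compThm t)
    valueThm t@(letbang _ _)  = comp→value t (compThm t)
    valueThm t@(tens _ _)     = comp→value t (compThm t)
    valueThm t@(lettens _ _)  = comp→value t (compThm t)
    valueThm t@(abort _)      = comp→value t (compThm t)
    valueThm t@(inl _)        = comp→value t (compThm t)
    valueThm t@(inr _)        = comp→value t (compThm t)
    valueThm t@(case _ _ _)   = comp→value t (compThm t)
    valueThm t@(lapp _ _)     = comp→value t (compThm t)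

    compThm : (t : Tm Γ Δ (U Y)) → CompThm t
    compThm (var x)       = value→comp (var x) (value-var x)
    compThm (fst t)       = value→comp (fst t) (value-fst t (valueThm t))
    compThm (snd t)       = value→comp (snd t) (value-snd t (valueThm t))
    compThm (app t u)     = value→comp (app t u) (value-app t u (valueThm t) (valueThm u))
    compThm sv            = comp-sv
    compThm cunit         = comp-cunit
    compThm (cpair t u)   = comp-cpair t u (compThm t) (compThm u)
    compThm (cfst t)      = comp-cfst t (compThm t)
    compThm (csnd t)      = comp-csnd t (compThm t)
    compThm (clam t)      = comp-clam t (compThm t)
    compThm (capp s t)    = comp-capp s t (compThm s) (valueThm t)
    compThm top           = comp-top
    compThm (lettop t u)  = comp-lettop t u (compThm t) (valueThm u)
    compThm (bang t)      = comp-bang t (valueThm t)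
    compThm (letbang t u) = comp-letbang t u (compThm t) (valueThm u)
    compThm (tens t u)    = comp-tens t u (valueThm t) (compThm u)
    compThm (lettens s t) = comp-lettens s t (compThm s) (compThm t)
    compThm (abort t)     = comp-abort t (compThm t)
    compThm (inl t)       = comp-inl t (compThm t)
    compThm (inr t)       = comp-inr t (compThm t)
    compThm (case s t u)  = comp-case s t u (compThm s) (compThm t) (compThm u)
    compThm (lapp s t)    = comp-lapp s t (valueThm s) (compThm t)

  stoupThm : (t : Tm Γ (just X) (U Y))
           → t ≋ sub (θsub Γ) (ssub (lapp (cl (θC Y)) (trC (trC t))) (lapp (cl (invC X)) sv))
  stoupThm {Γ = Γ} {X = X} {Y = Y} t = begin
    t                                              ≈⟨ compThm t ⟩
    Θc Y (tr²θ t)                                  ≡⟨ cong₂ (λ f g → lapp f (ssub T (lapp g sv)))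
                                                            (sub-cl (θsub Γ) (θC Y))
                                                            (sub-cl (θsub Γ) (invC X)) ⟨
    lapp (sub (θsub Γ) (cl (θC Y))) (ssub T (lapp (sub (θsub Γ) (cl (invC X))) sv))
                                                   ≡⟨ sub-ssub (θsub Γ) (lapp (cl (θC Y)) (trC (trC t)))
                                                                        (lapp (cl (invC X)) sv) ⟨
    sub (θsub Γ) (ssub (lapp (cl (θC Y)) (trC (trC t))) (lapp (cl (invC X)) sv))  ∎
    where T = sub (θsub Γ) (trC (trC t))

theorem5p4 : (R : CTy) (hR : ConstOrI R)
    (invV : (A : VTy) → Tm [] nothing (A t→ Translation.vt R (Translation.vt R A)))
    (invC : (X : CTy) → Tm [] nothing (X ⊸ Translation.ct R (Translation.ct R X))) →
    Theta.AreInverses R (RI R hR) invV invC →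
    let open Translation R
        open Theta R (RI R hR) invV invC
    in ((Γ : Ctx) (A : VTy) (t : Tm Γ nothing A) →
          t ≋ sub (θsub Γ) (app (cl (θV A)) (trV (trV t))))
     × ((Γ : Ctx) (X Y : CTy) (t : Tm Γ (just X) (U Y)) →
          t ≋ sub (θsub Γ) (ssub (lapp (cl (θC Y)) (trC (trC t))) (lapp (cl (invC X)) sv)))
theorem5p4 R hR invV invC inverses =
  (λ Γ A t → valueThm t) , (λ Γ X Y t → stoupThm t)
  where open Main R (RI R hR) invV invC inverses
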